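{- Let $n\ge3$ and $k\ge1$ be integers and let $G=PW(n,k)$ be the graph obtained from $k$ disjoint copies of the cycle $C_n$ by identifying one vertex from each copy into a single vertex. Then \[ \mathcal K_v(G)=\frac{(2k-1)(n^2-1)}{6}. \]
   Context: For a connected graph $G$ whose simple random walk transition matrix $P=D^{ -1}A$ has eigenvalues $1,\lambda_2,\dots,\lambda_N$, Kemeny's constant is $\mathcal K_v(G)=\sum_{j=2}^N\frac1{1-\lambda_j}$ (equivalently $\pi^\top M\pi$ with $\pi_i=\deg(i)/(2m)$ and $M$ the matrix of simple random walk mean first hitting times with zero diagonal). -}

module Defs where

open import Data.Nat as ℕ using (ℕ; zero; suc; _∸_)
open import Data.Integer as ℤ using (ℤ; +_)
open import Data.Rational as ℚ using (ℚ; 0ℚ; 1ℚ; _+_; _*_; _/_)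
open import Data.Bool using (Bool; true; false; if_then_else_; _∧_; _∨_)
open import Data.Fin as Fin using (Fin; toℕ)
open import Data.Fin.Properties using () renaming (_≟_ to _≟F_)
open import Data.List using (List; _∷_; []; map; allFin; cartesianProduct; foldr)
open import Data.Product using (_×_; _,_)
open import Data.Sum using (_⊎_; inj₁; inj₂)
open import Data.Unit using (⊤; tt)
open import Relation.Nullary using (¬_)
open import Relation.Nullary.Decidable using (⌊_⌋)
open import Relation.Binary.PropositionalEquality using (_≡_)

-- A finite simple graph given by an exhaustive, duplicate-free list of its
-- vertices and a symmetric, irreflexive Boolean adjacency relation.
record FinGraph : Set₁ where
  field
    V     : Set
    verts : List V
    adj   : V → V → Bool

module _ (G : FinGraph) where
  open FinGraph G

  Σv : (V → ℚ) → ℚ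
  Σv f = foldr (λ v acc → f v + acc) 0ℚ verts

  degℕ : V → ℕ
  degℕ v = foldr (λ w acc → if adj v w then suc acc else acc) 0 verts

  -- 1/d as a rational (with the harmless convention 1/0 = 0)
  recipℕ : ℕ → ℚ
  recipℕ zero    = 0ℚ
  recipℕ (suc d) = (+ 1) / suc d

  twoM : ℕ
  twoM = foldr (λ v acc → degℕ v ℕ.+ acc) 0 verts

  π : V → ℚ
  π i = ((+ degℕ i) / 1) * recipℕ twoM

  Pmat : V → V → ℚ
  Pmat i w = if adj i w then recipℕ (degℕ i) else 0ℚ

  -- M is the matrix of mean first hitting times of the simple random walk:
  -- M i i = 0 and, for i ≠ j, first-step analysis M i j = 1 + Σ_w P i w M w j.
  -- (For a connected graph this linear system has exactly one solution,
  -- the matrix of expected hitting times.)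
  IsHittingTimes : (V → V → ℚ) → Set
  IsHittingTimes M =
    (∀ i → M i i ≡ 0ℚ) ×
    (∀ i j → ¬ (i ≡ j) → M i j ≡ 1ℚ + Σv (λ w → Pmat i w * M w j))

  kemenyOf : (V → V → ℚ) → ℚ
  kemenyOf M = Σv (λ i → Σv (λ j → π i * M i j * π j))

-- Vertex inj₁ tt is the common (glued) vertex, playing the role of cycle
-- position 0 in every copy; inj₂ (c , j) is position j+1 (j = 0..n-2) of
-- copy c.  Positions are adjacent iff consecutive on the cycle; the glued
-- vertex is adjacent to positions 1 and n-1 of every copy.
PWVertex : ℕ → ℕ → Set
PWVertex n k = ⊤ ⊎ (Fin k × Fin (n ∸ 1))

_==_ : ℕ → ℕ → Bool
a == b = ⌊ a ℕ.≟ b ⌋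

endPos : ℕ → {m : ℕ} → Fin m → Bool
endPos n j = (toℕ j == 0) ∨ (suc (toℕ j) == (n ∸ 1))

PWadj : (n k : ℕ) → PWVertex n k → PWVertex n k → Bool
PWadj n k (inj₁ _) (inj₁ _) = false
PWadj n k (inj₁ _) (inj₂ (c , j)) = endPos n j
PWadj n k (inj₂ (c , j)) (inj₁ _) = endPos n j
PWadj n k (inj₂ (c , j)) (inj₂ (c' , j')) =
  ⌊ c ≟F c' ⌋ ∧ ((suc (toℕ j) == toℕ j') ∨ (suc (toℕ j') == toℕ j))

PW : ℕ → ℕ → FinGraph
PW n k = record
  { V     = PWVertex n k
  ; verts = inj₁ tt ∷ map inj₂ (cartesianProduct (allFin k) (allFin (n ∸ 1)))
  ; adj   = PWadj n k
  }

-- First-step analysis determines the hitting times, because on PW(n, k) a function that is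
-- harmonic off one vertex y and vanishes at y is zero: along each cycle it is affine on the
-- arcs between the hub and y, and harmonicity at the hub forces all slopes to vanish.
-- The same principle applies to i ↦ Σ_j M i j π j, which is harmonic everywhere by Kac's
-- formula π j (1 + Σ_w P j w M w j) = 1; hence it is constant, and the Kemeny constant is its
-- value at the hub. An explicit solution of the first-step equations has hub row
-- (2k - 1) Q (n - Q) at the vertices at position Q of a cycle, each of which has π = 1 / (k n),
-- and Σ_{Q = 1}^{n - 1} Q (n - Q) = (n - 1) n (n + 1) / 6.

module Submission where

open import Defs
open import Data.Nat using (ℕ; _≤_; _*_; _∸_)
open import Data.Integer using (+_)
open import Data.Rational using (ℚ; _/_)
open import Data.Product using (Σ; _×_)
open import Relation.Binary.PropositionalEquality using (_≡_)

open import Data.Bool using (Bool; true; false; if_then_else_; _∧_; _∨_)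
import Data.Bool.Properties as Boolₚ
open import Data.Empty using (⊥-elim)
open import Data.Fin as Fin using (Fin; toℕ)
import Data.Fin.Properties as Finₚ
import Data.Integer as ℤ
import Data.Integer.Properties as ℤₚ
open import Data.List using (List; []; _∷_; _++_; map; foldr; length; tabulate; allFin; cartesianProduct)
import Data.List.Properties as Listₚ
open import Data.List.Membership.Propositional using (_∈_)
open import Data.List.Membership.Propositional.Properties using (∈-allFin; ∈-map⁺; ∈-cartesianProduct⁺)
open import Data.List.Relation.Unary.All as All using (All; []; _∷_)
import Data.List.Relation.Unary.All.Properties as Allₚ
open import Data.List.Relation.Unary.AllPairs using (_∷_)
open import Data.List.Relation.Unary.Any using (here; there)
open import Data.List.Relation.Unary.Unique.Propositional using (Unique)
import Data.List.Relation.Unary.Unique.Propositional.Properties as Uniqueₚ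
open import Data.Nat as ℕ using (zero; suc; _<_; z≤n; s≤s)
import Data.Nat.Properties as ℕₚ
open import Data.Nat.Coprimality using (1-coprimeTo) renaming (sym to coprime-sym)
open import Data.Product using (_,_; proj₁; proj₂)
open import Data.Rational using (mkℚ; ↥_; 0ℚ; 1ℚ; _+_; _-_; -_) renaming (_*_ to _·_)
import Data.Rational.Properties as ℚₚ
open import Data.Rational.Solver using (module +-*-Solver)
open import Data.Sum using (inj₁; inj₂)
open import Data.Sum.Properties using (inj₂-injective)
open import Data.Unit using (tt)
open import Function using (_∘_; id)
open import Relation.Binary.Definitions using (tri<; tri≈; tri>)
open import Relation.Binary.PropositionalEquality using (refl; sym; trans; cong; cong₂; subst; _≢_; module ≡-Reasoning)
open import Relation.Nullary using (Dec; yes; no; ¬_)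
open import Relation.Nullary.Decidable using (⌊_⌋; isYes≗does; dec-true; dec-false)
open import Algebra.Properties.Group ℚₚ.+-0-group using ()
  renaming (x∙y⁻¹≈ε⇒x≈y to p-q≡0⇒p≡q; identityʳ-unique to +-identityʳ-unique)

open +-*-Solver
open ≡-Reasoning

-- Definitionally equal to the cast (+ degℕ G i) / 1 in the definition of π.
fromℕ : ℕ → ℚ
fromℕ a = + a / 1

private
  fromℕ≡mkℚ : ∀ a → fromℕ a ≡ mkℚ (+ a) 0 (coprime-sym (1-coprimeTo a))
  fromℕ≡mkℚ a = ℚₚ.normalize-coprime (coprime-sym (1-coprimeTo a))

  1/suc≡mkℚ : ∀ d → + 1 / suc d ≡ mkℚ (+ 1) d (1-coprimeTo (suc d))
  1/suc≡mkℚ d = ℚₚ.normalize-coprime (1-coprimeTo (suc d))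

fromℕ-+ : ∀ a b → fromℕ (a ℕ.+ b) ≡ fromℕ a + fromℕ b
fromℕ-+ a b = begin
  + (a ℕ.+ b) / 1                       ≡˘⟨ cong (_/ 1) (cong₂ ℤ._+_ (ℤₚ.*-identityʳ (+ a)) (ℤₚ.*-identityʳ (+ b))) ⟩
  (+ a ℤ.* + 1 ℤ.+ + b ℤ.* + 1) / 1     ≡˘⟨ cong₂ _+_ (fromℕ≡mkℚ a) (fromℕ≡mkℚ b) ⟩
  fromℕ a + fromℕ b                     ∎

fromℕ-* : ∀ a b → fromℕ (a ℕ.* b) ≡ fromℕ a · fromℕ b
fromℕ-* a b = trans (cong (_/ 1) (ℤₚ.pos-* a b)) (sym (cong₂ _·_ (fromℕ≡mkℚ a) (fromℕ≡mkℚ b)))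

fromℕ-suc : ∀ a → fromℕ (suc a) ≡ 1ℚ + fromℕ a
fromℕ-suc = fromℕ-+ 1

fromℕ-2+ : ∀ a → fromℕ (suc (suc a)) ≡ 1ℚ + (1ℚ + fromℕ a)
fromℕ-2+ a = trans (fromℕ-suc (suc a)) (cong (_+_ 1ℚ) (fromℕ-suc a))

fromℕ-∸ : ∀ {a b} → b ≤ a → fromℕ (a ∸ b) ≡ fromℕ a - fromℕ b
fromℕ-∸ {a} {b} b≤a = begin
  fromℕ (a ∸ b)                        ≡⟨ solve 2 (λ x y → x := (x :+ y) :- y) refl (fromℕ (a ∸ b)) (fromℕ b) ⟩
  fromℕ (a ∸ b) + fromℕ b - fromℕ b    ≡˘⟨ cong (_- fromℕ b) (fromℕ-+ (a ∸ b) b) ⟩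
  fromℕ (a ∸ b ℕ.+ b) - fromℕ b        ≡⟨ cong (λ x → fromℕ x - fromℕ b) (ℕₚ.m∸n+n≡m b≤a) ⟩
  fromℕ a - fromℕ b                    ∎

fromℕ-injective : ∀ {a b} → fromℕ a ≡ fromℕ b → a ≡ b
fromℕ-injective {a} {b} e = ℤₚ.+-injective (cong ↥_ (trans (sym (fromℕ≡mkℚ a)) (trans e (fromℕ≡mkℚ b))))

fromℕ-inverseʳ : ∀ d → fromℕ (suc d) · (+ 1 / suc d) ≡ 1ℚ
fromℕ-inverseʳ d = trans (cong₂ _·_ (fromℕ≡mkℚ (suc d)) (1/suc≡mkℚ d)) (ℚₚ.*-inverseʳ (mkℚ (+ suc d) 0 (coprime-sym (1-coprimeTo (suc d)))))

/≡fromℕ·1/ : ∀ a d → + a / suc d ≡ fromℕ a · (+ 1 / suc d)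
/≡fromℕ·1/ a d = trans (ℚₚ./-cong {+ a} {suc d} {+ a ℤ.* + 1} {1 ℕ.* suc d} (sym (ℤₚ.*-identityʳ (+ a))) (sym (ℕₚ.*-identityˡ (suc d))))
                          (sym (cong₂ _·_ (fromℕ≡mkℚ a) (1/suc≡mkℚ d)))

fromℕ-recipℕ : ∀ G {d} → d ≢ 0 → fromℕ d · recipℕ G d ≡ 1ℚ
fromℕ-recipℕ G {zero}  d≢0 = ⊥-elim (d≢0 refl)
fromℕ-recipℕ G {suc d} _   = fromℕ-inverseʳ d

fromℕ-suc·p≡0⇒p≡0 : ∀ a p → fromℕ (suc a) · p ≡ 0ℚ → p ≡ 0ℚ
fromℕ-suc·p≡0⇒p≡0 a p e = begin
  p                         ≡˘⟨ ℚₚ.*-identityˡ p ⟩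
  1ℚ · p                    ≡˘⟨ cong (_· p) (trans (ℚₚ.*-comm r (fromℕ (suc a))) (fromℕ-inverseʳ a)) ⟩
  (r · fromℕ (suc a)) · p   ≡⟨ ℚₚ.*-assoc r (fromℕ (suc a)) p ⟩
  r · (fromℕ (suc a) · p)   ≡⟨ cong (r ·_) e ⟩
  r · 0ℚ                    ≡⟨ ℚₚ.*-zeroʳ r ⟩
  0ℚ                        ∎
  where
  r : ℚ
  r = + 1 / suc a

∑ : {A : Set} → List A → (A → ℚ) → ℚ
∑ xs f = foldr (λ x acc → f x + acc) 0ℚ xs

Enumerates : {A : Set} → List A → Set
Enumerates xs = Unique xs × (∀ x → x ∈ xs)

module _ {A : Set} where

  ∑-cong : ∀ xs {f g : A → ℚ} → (∀ x → f x ≡ g x) → ∑ xs f ≡ ∑ xs g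
  ∑-cong []       f≗g = refl
  ∑-cong (x ∷ xs) f≗g = cong₂ _+_ (f≗g x) (∑-cong xs f≗g)

  ∑-+ : ∀ xs (f g : A → ℚ) → ∑ xs (λ x → f x + g x) ≡ ∑ xs f + ∑ xs g
  ∑-+ []       f g = refl
  ∑-+ (x ∷ xs) f g = trans (cong (_+_ (f x + g x)) (∑-+ xs f g))
    (solve 4 (λ a b c d → (a :+ b) :+ (c :+ d) := (a :+ c) :+ (b :+ d)) refl (f x) (g x) (∑ xs f) (∑ xs g))

  ∑-·ˡ : ∀ xs c (f : A → ℚ) → ∑ xs (λ x → c · f x) ≡ c · ∑ xs f
  ∑-·ˡ []       c f = sym (ℚₚ.*-zeroʳ c)
  ∑-·ˡ (x ∷ xs) c f = trans (cong (_+_ (c · f x)) (∑-·ˡ xs c f)) (sym (ℚₚ.*-distribˡ-+ c (f x) (∑ xs f)))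

  ∑-·ʳ : ∀ xs (f : A → ℚ) c → ∑ xs (λ x → f x · c) ≡ ∑ xs f · c
  ∑-·ʳ xs f c = trans (∑-cong xs (λ x → ℚₚ.*-comm (f x) c)) (trans (∑-·ˡ xs c f) (ℚₚ.*-comm c (∑ xs f)))

  ∑-neg : ∀ xs (f : A → ℚ) → ∑ xs (λ x → - f x) ≡ - ∑ xs f
  ∑-neg []       f = refl
  ∑-neg (x ∷ xs) f = trans (cong (_+_ (- f x)) (∑-neg xs f)) (sym (ℚₚ.neg-distrib-+ (f x) (∑ xs f)))

  ∑-- : ∀ xs (f g : A → ℚ) → ∑ xs (λ x → f x - g x) ≡ ∑ xs f - ∑ xs g
  ∑-- xs f g = trans (∑-+ xs f (λ x → - g x)) (cong (_+_ (∑ xs f)) (∑-neg xs g))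

  ∑-+-- : ∀ xs (f g h : A → ℚ) → ∑ xs (λ x → f x + g x - h x) ≡ ∑ xs f + ∑ xs g - ∑ xs h
  ∑-+-- xs f g h = trans (∑-- xs (λ x → f x + g x) h) (cong (_- ∑ xs h) (∑-+ xs f g))

  ∑-const : ∀ xs c → ∑ xs (λ (_ : A) → c) ≡ fromℕ (length xs) · c
  ∑-const []       c = sym (ℚₚ.*-zeroˡ c)
  ∑-const (x ∷ xs) c = begin
    c + ∑ xs (λ _ → c)                 ≡⟨ cong (_+_ c) (∑-const xs c) ⟩
    c + fromℕ (length xs) · c          ≡⟨ solve 2 (λ c l → c :+ l :* c := (con 1ℚ :+ l) :* c) refl c (fromℕ (length xs)) ⟩
    (1ℚ + fromℕ (length xs)) · c       ≡˘⟨ cong (_· c) (fromℕ-suc (length xs)) ⟩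
    fromℕ (suc (length xs)) · c        ∎

  ∑-++ : ∀ xs ys (f : A → ℚ) → ∑ (xs ++ ys) f ≡ ∑ xs f + ∑ ys f
  ∑-++ []       ys f = sym (ℚₚ.+-identityˡ (∑ ys f))
  ∑-++ (x ∷ xs) ys f = trans (cong (_+_ (f x)) (∑-++ xs ys f)) (sym (ℚₚ.+-assoc (f x) (∑ xs f) (∑ ys f)))

  ∑-zero : ∀ {xs} {f : A → ℚ} → All (λ x → f x ≡ 0ℚ) xs → ∑ xs f ≡ 0ℚ
  ∑-zero []         = refl
  ∑-zero (fx≡0 ∷ p) = cong₂ _+_ fx≡0 (∑-zero p)

  private
    ∑-single′ : ∀ {xs i} {f : A → ℚ} → Unique xs → i ∈ xs → All (λ x → x ≢ i → f x ≡ 0ℚ) xs → ∑ xs f ≡ f i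
    ∑-single′ {f = f} (i∉ ∷ _) (here {x = i} refl) (_ ∷ p) =
      trans (cong (_+_ (f i)) (∑-zero (All.zipWith (λ (i≢x , h) → h (i≢x ∘ sym)) (i∉ , p)))) (ℚₚ.+-identityʳ (f i))
    ∑-single′ (x∉ ∷ u) (there i∈) (h ∷ p) =
      trans (cong₂ _+_ (h (All.lookup x∉ i∈)) (∑-single′ u i∈ p)) (ℚₚ.+-identityˡ _)

    ∑-pair′ : ∀ {xs a b} {f : A → ℚ} → Unique xs → a ∈ xs → b ∈ xs → a ≢ b →
              All (λ x → x ≢ a → x ≢ b → f x ≡ 0ℚ) xs → ∑ xs f ≡ f a + f b
    ∑-pair′ _ (here refl) (here refl) a≢b _ = ⊥-elim (a≢b refl)
    ∑-pair′ {f = f} (a∉ ∷ u) (here {x = a} refl) (there b∈) _ (_ ∷ p) =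
      cong (_+_ (f a)) (∑-single′ u b∈ (All.zipWith (λ (a≢x , h) → h (a≢x ∘ sym)) (a∉ , p)))
    ∑-pair′ {a = a} {f = f} (b∉ ∷ u) (there a∈) (here {x = b} refl) _ (_ ∷ p) =
      trans (cong (_+_ (f b)) (∑-single′ u a∈ (All.zipWith (λ (b≢x , h) x≢a → h x≢a (b≢x ∘ sym)) (b∉ , p))))
            (ℚₚ.+-comm (f b) (f a))
    ∑-pair′ (x∉ ∷ u) (there a∈) (there b∈) a≢b (h ∷ p) =
      trans (cong₂ _+_ (h (All.lookup x∉ a∈) (All.lookup x∉ b∈)) (∑-pair′ u a∈ b∈ a≢b p)) (ℚₚ.+-identityˡ _)

  ∑-single : ∀ {xs} → Enumerates xs → ∀ {i} {f : A → ℚ} → (∀ x → x ≢ i → f x ≡ 0ℚ) → ∑ xs f ≡ f i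
  ∑-single {xs} (u , ∈xs) f≡0 = ∑-single′ u (∈xs _) (All.universal f≡0 xs)

  ∑-pair : ∀ {xs} → Enumerates xs → ∀ {a b} {f : A → ℚ} → a ≢ b →
           (∀ x → x ≢ a → x ≢ b → f x ≡ 0ℚ) → ∑ xs f ≡ f a + f b
  ∑-pair {xs} (u , ∈xs) a≢b f≡0 = ∑-pair′ u (∈xs _) (∈xs _) a≢b (All.universal f≡0 xs)

∑-map : {A B : Set} (g : A → B) (xs : List A) (f : B → ℚ) → ∑ (map g xs) f ≡ ∑ xs (f ∘ g)
∑-map g []       f = refl
∑-map g (x ∷ xs) f = cong (_+_ (f (g x))) (∑-map g xs f)

∑-swap : {A B : Set} (xs : List A) (ys : List B) (f : A → B → ℚ) →
         ∑ xs (λ x → ∑ ys (f x)) ≡ ∑ ys (λ y → ∑ xs (λ x → f x y))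
∑-swap []       ys f = sym (∑-zero (All.universal (λ _ → refl) ys))
∑-swap (x ∷ xs) ys f = trans (cong (_+_ (∑ ys (f x))) (∑-swap xs ys f)) (sym (∑-+ ys (f x) (λ y → ∑ xs (λ x → f x y))))

∑-cartesianProduct : {A B : Set} (xs : List A) (ys : List B) (f : A × B → ℚ) →
                     ∑ (cartesianProduct xs ys) f ≡ ∑ xs (λ x → ∑ ys (λ y → f (x , y)))
∑-cartesianProduct []       ys f = refl
∑-cartesianProduct (x ∷ xs) ys f =
  trans (∑-++ (map (x ,_) ys) _ f) (cong₂ _+_ (∑-map (x ,_) ys f) (∑-cartesianProduct xs ys f))

allFin-enumerates : ∀ n → Enumerates (allFin n)
allFin-enumerates n = Uniqueₚ.allFin⁺ n , ∈-allFin

length-allFin : ∀ n → length (allFin n) ≡ n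
length-allFin n = Listₚ.length-tabulate id

∑-telescope : ∀ L (F : ℕ → ℚ) → ∑ (allFin L) (λ t → F (suc (toℕ t)) - F (toℕ t)) ≡ F L - F 0
∑-telescope zero    F = sym (ℚₚ.+-inverseʳ (F 0))
∑-telescope (suc L) F = begin
  (F 1 - F 0) + ∑ (tabulate Fin.suc) φ         ≡˘⟨ cong (λ ys → (F 1 - F 0) + ∑ ys φ) (Listₚ.map-tabulate id Fin.suc) ⟩
  (F 1 - F 0) + ∑ (map Fin.suc (allFin L)) φ   ≡⟨ cong (_+_ (F 1 - F 0)) (∑-map Fin.suc (allFin L) φ) ⟩
  (F 1 - F 0) + ∑ (allFin L) (φ ∘ Fin.suc)     ≡⟨ cong (_+_ (F 1 - F 0)) (∑-telescope L (F ∘ suc)) ⟩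
  (F 1 - F 0) + (F (suc L) - F 1)              ≡⟨ solve 3 (λ a b c → (b :- a) :+ (c :- b) := c :- a) refl (F 0) (F 1) (F (suc L)) ⟩
  F (suc L) - F 0                              ∎
  where
  φ : Fin (suc L) → ℚ
  φ t = F (suc (toℕ t)) - F (toℕ t)

∑-allFin-const : ∀ L c → ∑ (allFin L) (λ _ → c) ≡ fromℕ L · c
∑-allFin-const L c = trans (∑-const (allFin L) c) (cong (λ l → fromℕ l · c) (length-allFin L))

∑-allFin-except : ∀ L {i : Fin L} {f : Fin L → ℚ} {c} → (∀ x → x ≢ i → f x ≡ c) →
                  ∑ (allFin L) f ≡ fromℕ L · c + (f i - c)
∑-allFin-except L {i} {f} {c} f≡c = begin
  ∑ (allFin L) f                                       ≡⟨ ∑-cong (allFin L) (λ x → solve 2 (λ y c → y := c :+ (y :- c)) refl (f x) c) ⟩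
  ∑ (allFin L) (λ x → c + (f x - c))                   ≡⟨ ∑-+ (allFin L) (λ _ → c) (λ x → f x - c) ⟩
  ∑ (allFin L) (λ _ → c) + ∑ (allFin L) (λ x → f x - c) ≡⟨ cong₂ _+_ (∑-allFin-const L c) (∑-single (allFin-enumerates L) deviation≡0) ⟩
  fromℕ L · c + (f i - c)                              ∎
  where
  deviation≡0 : ∀ x → x ≢ i → f x - c ≡ 0ℚ
  deviation≡0 x x≢i = trans (cong (_- c) (f≡c x x≢i)) (ℚₚ.+-inverseʳ c)

fromℕ-count : {A : Set} (b : A → Bool) (xs : List A) →
              fromℕ (foldr (λ x acc → if b x then suc acc else acc) 0 xs) ≡ ∑ xs (λ x → if b x then 1ℚ else 0ℚ)
fromℕ-count b []       = refl
fromℕ-count b (x ∷ xs) with b x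
... | true  = trans (fromℕ-suc (foldr (λ x acc → if b x then suc acc else acc) 0 xs)) (cong (_+_ 1ℚ) (fromℕ-count b xs))
... | false = trans (fromℕ-count b xs) (sym (ℚₚ.+-identityˡ _))

fromℕ-sum : {A : Set} (g : A → ℕ) (xs : List A) →
            fromℕ (foldr (λ x acc → g x ℕ.+ acc) 0 xs) ≡ ∑ xs (fromℕ ∘ g)
fromℕ-sum g []       = refl
fromℕ-sum g (x ∷ xs) = trans (fromℕ-+ (g x) _) (cong (_+_ (fromℕ (g x))) (fromℕ-sum g xs))

sum≡0⇒summand≡0 : {A : Set} (g : A → ℕ) {xs : List A} {x : A} →
           foldr (λ x acc → g x ℕ.+ acc) 0 xs ≡ 0 → x ∈ xs → g x ≡ 0
sum≡0⇒summand≡0 g {y ∷ _} sum≡0 (here refl) = ℕₚ.m+n≡0⇒m≡0 (g y) sum≡0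
sum≡0⇒summand≡0 g {y ∷ _} sum≡0 (there x∈) = sum≡0⇒summand≡0 g (ℕₚ.m+n≡0⇒n≡0 (g y) sum≡0) x∈

-- Simple random walk on a finite graph

module Walk (G : FinGraph) where
  open FinGraph G

  deg : V → ℕ
  deg = degℕ G

  neighbourSum : V → (V → ℚ) → ℚ
  neighbourSum x F = ∑ verts (λ w → if adj x w then F w else 0ℚ)

  step : V → (V → ℚ) → ℚ
  step x F = ∑ verts (λ w → Pmat G x w · F w)

  HarmonicAt : V → (V → ℚ) → Set
  HarmonicAt x F = F x ≡ step x F

  -- On a connected graph this follows from the maximum principle.
  DirichletUniqueness : Set
  DirichletUniqueness = ∀ y (F : V → ℚ) → F y ≡ 0ℚ → (∀ x → x ≢ y → HarmonicAt x F) → ∀ x → F x ≡ 0ℚ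

  fromℕ-deg : ∀ x → fromℕ (deg x) ≡ neighbourSum x (λ _ → 1ℚ)
  fromℕ-deg x = fromℕ-count (adj x) verts

  step-neighbourSum : ∀ x F → step x F ≡ recipℕ G (deg x) · neighbourSum x F
  step-neighbourSum x F = trans (∑-cong verts pointwise) (∑-·ˡ verts (recipℕ G (deg x)) _)
    where
    pointwise : ∀ w → Pmat G x w · F w ≡ recipℕ G (deg x) · (if adj x w then F w else 0ℚ)
    pointwise w with adj x w
    ... | true  = refl
    ... | false = trans (ℚₚ.*-zeroˡ (F w)) (sym (ℚₚ.*-zeroʳ (recipℕ G (deg x))))

  step-- : ∀ x F F′ → step x (λ w → F w - F′ w) ≡ step x F - step x F′
  step-- x F F′ = trans (∑-cong verts (λ w → solve 3 (λ p a b → p :* (a :- b) := p :* a :- p :* b) refl (Pmat G x w) (F w) (F′ w)))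
                        (∑-- verts (λ w → Pmat G x w · F w) (λ w → Pmat G x w · F′ w))

  module Undirected (enum : Enumerates verts) (adj-sym : ∀ v w → adj v w ≡ adj w v)
                    (deg≢0 : ∀ v → deg v ≢ 0) where

    deg-recip : ∀ x → fromℕ (deg x) · recipℕ G (deg x) ≡ 1ℚ
    deg-recip x = fromℕ-recipℕ G (deg≢0 x)

    neighbourSum⇒firstStep : ∀ x F a → fromℕ (deg x) · a ≡ fromℕ (deg x) + neighbourSum x F → a ≡ 1ℚ + step x F
    neighbourSum⇒firstStep x F a balance = begin
      a                           ≡˘⟨ ℚₚ.*-identityˡ a ⟩
      1ℚ · a                      ≡˘⟨ cong (_· a) (deg-recip x) ⟩
      (d · r) · a                 ≡⟨ solve 3 (λ d r a → (d :* r) :* a := r :* (d :* a)) refl d r a ⟩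
      r · (d · a)                 ≡⟨ cong (r ·_) balance ⟩
      r · (d + neighbourSum x F)  ≡⟨ solve 3 (λ d r s → r :* (d :+ s) := d :* r :+ r :* s) refl d r (neighbourSum x F) ⟩
      d · r + r · neighbourSum x F ≡⟨ cong₂ _+_ (deg-recip x) (sym (step-neighbourSum x F)) ⟩
      1ℚ + step x F               ∎
      where
      d r : ℚ
      d = fromℕ (deg x)
      r = recipℕ G (deg x)

    harmonic⇒neighbourSum : ∀ x F → HarmonicAt x F → fromℕ (deg x) · F x ≡ neighbourSum x F
    harmonic⇒neighbourSum x F harmonic = begin
      d · F x                     ≡⟨ cong (d ·_) (trans harmonic (step-neighbourSum x F)) ⟩
      d · (r · neighbourSum x F)  ≡˘⟨ ℚₚ.*-assoc d r _ ⟩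
      (d · r) · neighbourSum x F  ≡⟨ cong (_· neighbourSum x F) (deg-recip x) ⟩
      1ℚ · neighbourSum x F       ≡⟨ ℚₚ.*-identityˡ _ ⟩
      neighbourSum x F            ∎
      where
      d r : ℚ
      d = fromℕ (deg x)
      r = recipℕ G (deg x)

    step-const : ∀ x c → step x (λ _ → c) ≡ c
    step-const x c = begin
      step x (λ _ → c)          ≡⟨ ∑-·ʳ verts (Pmat G x) c ⟩
      ∑ verts (Pmat G x) · c    ≡⟨ cong (_· c) rowSum ⟩
      1ℚ · c                    ≡⟨ ℚₚ.*-identityˡ c ⟩
      c                         ∎
      where
      rowSum : ∑ verts (Pmat G x) ≡ 1ℚ
      rowSum = begin
        ∑ verts (Pmat G x)                                ≡˘⟨ ∑-cong verts (λ w → ℚₚ.*-identityʳ (Pmat G x w)) ⟩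
        step x (λ _ → 1ℚ)                                 ≡⟨ step-neighbourSum x (λ _ → 1ℚ) ⟩
        recipℕ G (deg x) · neighbourSum x (λ _ → 1ℚ)      ≡˘⟨ cong (recipℕ G (deg x) ·_) (fromℕ-deg x) ⟩
        recipℕ G (deg x) · fromℕ (deg x)                  ≡⟨ ℚₚ.*-comm (recipℕ G (deg x)) (fromℕ (deg x)) ⟩
        fromℕ (deg x) · recipℕ G (deg x)                  ≡⟨ deg-recip x ⟩
        1ℚ                                                ∎

    twoM≢0 : V → twoM G ≢ 0
    twoM≢0 v twoM≡0 = deg≢0 v (sum≡0⇒summand≡0 deg twoM≡0 (proj₂ enum v))

    π-sum : V → ∑ verts (π G) ≡ 1ℚ
    π-sum v = begin
      ∑ verts (λ i → fromℕ (deg i) · R)   ≡⟨ ∑-·ʳ verts (fromℕ ∘ deg) R ⟩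
      ∑ verts (fromℕ ∘ deg) · R           ≡˘⟨ cong (_· R) (fromℕ-sum deg verts) ⟩
      fromℕ (twoM G) · R                  ≡⟨ fromℕ-recipℕ G (twoM≢0 v) ⟩
      1ℚ                                  ∎
      where
      R : ℚ
      R = recipℕ G (twoM G)

    π-stationary : ∀ F → ∑ verts (λ i → π G i · step i F) ≡ ∑ verts (λ w → π G w · F w)
    π-stationary F = begin
      ∑ verts (λ i → π G i · step i F)                          ≡˘⟨ ∑-cong verts (λ i → ∑-·ˡ verts (π G i) _) ⟩
      ∑ verts (λ i → ∑ verts (λ w → π G i · (Pmat G i w · F w))) ≡⟨ ∑-swap verts verts (λ i w → π G i · (Pmat G i w · F w)) ⟩
      ∑ verts (λ w → ∑ verts (λ i → π G i · (Pmat G i w · F w))) ≡⟨ ∑-cong verts (λ w → trans (∑-cong verts (λ i → sym (ℚₚ.*-assoc (π G i) (Pmat G i w) (F w)))) (∑-·ʳ verts (λ i → π G i · Pmat G i w) (F w))) ⟩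
      ∑ verts (λ w → ∑ verts (λ i → π G i · Pmat G i w) · F w)  ≡⟨ ∑-cong verts (λ w → cong (_· F w) (invariant w)) ⟩
      ∑ verts (λ w → π G w · F w)                               ∎
      where
      R : ℚ
      R = recipℕ G (twoM G)
      weight : ∀ i (b : Bool) → (fromℕ (deg i) · R) · (if b then recipℕ G (deg i) else 0ℚ) ≡ R · (if b then 1ℚ else 0ℚ)
      weight i true  = trans (solve 3 (λ d R r → (d :* R) :* r := R :* (d :* r)) refl (fromℕ (deg i)) R _) (cong (R ·_) (deg-recip i))
      weight i false = trans (ℚₚ.*-zeroʳ (fromℕ (deg i) · R)) (sym (ℚₚ.*-zeroʳ R))
      invariant : ∀ w → ∑ verts (λ i → π G i · Pmat G i w) ≡ π G w
      invariant w = begin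
        ∑ verts (λ i → π G i · Pmat G i w)                 ≡⟨ ∑-cong verts (λ i → trans (weight i (adj i w)) (cong (λ b → R · (if b then 1ℚ else 0ℚ)) (adj-sym i w))) ⟩
        ∑ verts (λ i → R · (if adj w i then 1ℚ else 0ℚ))   ≡⟨ ∑-·ˡ verts R _ ⟩
        R · neighbourSum w (λ _ → 1ℚ)                      ≡˘⟨ cong (R ·_) (fromℕ-deg w) ⟩
        R · fromℕ (deg w)                                  ≡⟨ ℚₚ.*-comm R _ ⟩
        π G w                                              ∎

    hittingTimes-unique : DirichletUniqueness → ∀ {M M′} → IsHittingTimes G M → IsHittingTimes G M′ → ∀ x y → M x y ≡ M′ x y
    hittingTimes-unique dirichlet {M} {M′} (M-diag , M-step) (M′-diag , M′-step) x y =
      p-q≡0⇒p≡q (M x y) (M′ x y) (dirichlet y D D-target D-harmonic x)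
      where
      D : V → ℚ
      D w = M w y - M′ w y
      D-target : D y ≡ 0ℚ
      D-target = cong₂ _-_ (M-diag y) (M′-diag y)
      D-harmonic : ∀ x → x ≢ y → HarmonicAt x D
      D-harmonic x x≢y = begin
        M x y - M′ x y                                                ≡⟨ cong₂ _-_ (M-step x y x≢y) (M′-step x y x≢y) ⟩
        (1ℚ + step x (λ w → M w y)) - (1ℚ + step x (λ w → M′ w y))    ≡⟨ solve 2 (λ a b → (con 1ℚ :+ a) :- (con 1ℚ :+ b) := a :- b) refl (step x (λ w → M w y)) (step x (λ w → M′ w y)) ⟩
        step x (λ w → M w y) - step x (λ w → M′ w y)                  ≡˘⟨ step-- x (λ w → M w y) (λ w → M′ w y) ⟩
        step x D                                                      ∎

    module HittingTimes {M : V → V → ℚ} (hitting : IsHittingTimes G M) where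

      -- Zero off the diagonal by the first-step equations; on the diagonal, the mean return time.
      stepDefect : V → V → ℚ
      stepDefect i j = 1ℚ + step i (λ w → M w j) - M i j

      stepDefect-offDiagonal : ∀ {i j} → i ≢ j → stepDefect i j ≡ 0ℚ
      stepDefect-offDiagonal {i} {j} i≢j =
        trans (cong (_-_ (1ℚ + step i (λ w → M w j))) (proj₂ hitting i j i≢j)) (ℚₚ.+-inverseʳ (1ℚ + step i (λ w → M w j)))

      stepDefect-diagonal : ∀ j → stepDefect j j ≡ 1ℚ + step j (λ w → M w j)
      stepDefect-diagonal j =
        trans (cong (_-_ (1ℚ + step j (λ w → M w j))) (proj₁ hitting j)) (solve 1 (λ a → a :- con 0ℚ := a) refl (1ℚ + step j (λ w → M w j)))

      kac : ∀ j → π G j · (1ℚ + step j (λ w → M w j)) ≡ 1ℚ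
      kac j = begin
        π G j · (1ℚ + step j Mj)                                      ≡˘⟨ cong (π G j ·_) (stepDefect-diagonal j) ⟩
        π G j · stepDefect j j                                        ≡˘⟨ ∑-single enum (λ i i≢j → trans (cong (π G i ·_) (stepDefect-offDiagonal i≢j)) (ℚₚ.*-zeroʳ (π G i))) ⟩
        ∑ verts (λ i → π G i · stepDefect i j)                        ≡⟨ ∑-cong verts (λ i → solve 3 (λ p s m → p :* (con 1ℚ :+ s :- m) := p :+ p :* s :- p :* m) refl (π G i) (step i Mj) (M i j)) ⟩
        ∑ verts (λ i → π G i + π G i · step i Mj - π G i · M i j)     ≡⟨ ∑-+-- verts (π G) (λ i → π G i · step i Mj) (λ i → π G i · M i j) ⟩
        ∑ verts (π G) + ∑ verts (λ i → π G i · step i Mj) - X         ≡⟨ cong₂ (λ a b → a + b - X) (π-sum j) (π-stationary Mj) ⟩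
        1ℚ + X - X                                                    ≡⟨ solve 1 (λ x → con 1ℚ :+ x :- x := con 1ℚ) refl X ⟩
        1ℚ                                                            ∎
        where
        Mj : V → ℚ
        Mj w = M w j
        X : ℚ
        X = ∑ verts (λ i → π G i · M i j)

      kemenyRow : V → ℚ
      kemenyRow i = ∑ verts (λ j → M i j · π G j)

      kemenyRow-harmonic : ∀ i → HarmonicAt i kemenyRow
      kemenyRow-harmonic i = p-q≡0⇒p≡q (kemenyRow i) (step i kemenyRow) (begin
        kemenyRow i - step i kemenyRow                  ≡⟨ solve 2 (λ k s → k :- s := con 1ℚ :- (con 1ℚ :+ s :- k)) refl (kemenyRow i) (step i kemenyRow) ⟩
        1ℚ - (1ℚ + step i kemenyRow - kemenyRow i)      ≡⟨ cong (_-_ 1ℚ) balance ⟩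
        1ℚ - 1ℚ                                         ≡⟨ ℚₚ.+-inverseʳ 1ℚ ⟩
        0ℚ                                              ∎)
        where
        Mi : V → ℚ
        Mi w = M w i
        stepRow : ∑ verts (λ j → step i (λ w → M w j) · π G j) ≡ step i kemenyRow
        stepRow = begin
          ∑ verts (λ j → step i (λ w → M w j) · π G j)                    ≡˘⟨ ∑-cong verts (λ j → ∑-·ʳ verts (λ w → Pmat G i w · M w j) (π G j)) ⟩
          ∑ verts (λ j → ∑ verts (λ w → Pmat G i w · M w j · π G j))      ≡⟨ ∑-swap verts verts (λ j w → Pmat G i w · M w j · π G j) ⟩
          ∑ verts (λ w → ∑ verts (λ j → Pmat G i w · M w j · π G j))      ≡⟨ ∑-cong verts (λ w → trans (∑-cong verts (λ j → ℚₚ.*-assoc (Pmat G i w) (M w j) (π G j))) (∑-·ˡ verts (Pmat G i w) (λ j → M w j · π G j))) ⟩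
          step i kemenyRow                                                ∎
        balance : 1ℚ + step i kemenyRow - kemenyRow i ≡ 1ℚ
        balance = begin
          1ℚ + step i kemenyRow - kemenyRow i                                                    ≡˘⟨ cong₂ (λ a b → a + b - kemenyRow i) (π-sum i) stepRow ⟩
          ∑ verts (π G) + ∑ verts (λ j → step i (λ w → M w j) · π G j) - kemenyRow i             ≡˘⟨ ∑-+-- verts (π G) (λ j → step i (λ w → M w j) · π G j) (λ j → M i j · π G j) ⟩
          ∑ verts (λ j → π G j + step i (λ w → M w j) · π G j - M i j · π G j)                   ≡˘⟨ ∑-cong verts (λ j → solve 3 (λ s m p → (con 1ℚ :+ s :- m) :* p := p :+ s :* p :- m :* p) refl (step i (λ w → M w j)) (M i j) (π G j)) ⟩
          ∑ verts (λ j → stepDefect i j · π G j)                                                 ≡⟨ ∑-single enum (λ j j≢i → trans (cong (_· π G j) (stepDefect-offDiagonal (j≢i ∘ sym))) (ℚₚ.*-zeroˡ (π G j))) ⟩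
          stepDefect i i · π G i                                                                 ≡⟨ cong (_· π G i) (stepDefect-diagonal i) ⟩
          (1ℚ + step i Mi) · π G i                                                               ≡⟨ ℚₚ.*-comm (1ℚ + step i Mi) (π G i) ⟩
          π G i · (1ℚ + step i Mi)                                                               ≡⟨ kac i ⟩
          1ℚ                                                                                     ∎

      kemenyRow-constant : DirichletUniqueness → ∀ i o → kemenyRow i ≡ kemenyRow o
      kemenyRow-constant dirichlet i o =
        p-q≡0⇒p≡q (kemenyRow i) (kemenyRow o) (dirichlet o D (ℚₚ.+-inverseʳ (kemenyRow o)) D-harmonic i)
        where
        D : V → ℚ
        D w = kemenyRow w - kemenyRow o
        D-harmonic : ∀ x → x ≢ o → HarmonicAt x D
        D-harmonic x _ = begin
          kemenyRow x - kemenyRow o                          ≡⟨ cong₂ _-_ (kemenyRow-harmonic x) (sym (step-const x (kemenyRow o))) ⟩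
          step x kemenyRow - step x (λ _ → kemenyRow o)      ≡˘⟨ step-- x kemenyRow (λ _ → kemenyRow o) ⟩
          step x D                                           ∎

      kemenyOf-row : DirichletUniqueness → ∀ o → kemenyOf G M ≡ kemenyRow o
      kemenyOf-row dirichlet o = begin
        ∑ verts (λ i → ∑ verts (λ j → π G i · M i j · π G j))   ≡⟨ ∑-cong verts (λ i → trans (∑-cong verts (λ j → ℚₚ.*-assoc (π G i) (M i j) (π G j))) (∑-·ˡ verts (π G i) (λ j → M i j · π G j))) ⟩
        ∑ verts (λ i → π G i · kemenyRow i)                     ≡⟨ ∑-cong verts (λ i → cong (π G i ·_) (kemenyRow-constant dirichlet i o)) ⟩
        ∑ verts (λ i → π G i · kemenyRow o)                     ≡⟨ ∑-·ʳ verts (π G) (kemenyRow o) ⟩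
        ∑ verts (π G) · kemenyRow o                             ≡⟨ cong (_· kemenyRow o) (π-sum o) ⟩
        1ℚ · kemenyRow o                                        ≡⟨ ℚₚ.*-identityˡ (kemenyRow o) ⟩
        kemenyRow o                                             ∎

affine-on-path : ∀ (f : ℕ → ℚ) L → (∀ t → t < L → fromℕ 2 · f (suc t) ≡ f t + f (suc (suc t))) →
                 ∀ t → t ≤ suc L → f t ≡ f 0 + fromℕ t · (f 1 - f 0)
affine-on-path f L harmonic = affine
  where
  φ : ℕ → ℚ
  φ t = f 0 + fromℕ t · (f 1 - f 0)
  consecutive : ∀ t → t ≤ L → f t ≡ φ t × f (suc t) ≡ φ (suc t)
  consecutive zero _ =
    solve 2 (λ a b → a := a :+ con 0ℚ :* (b :- a)) refl (f 0) (f 1) ,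
    solve 2 (λ a b → b := a :+ con 1ℚ :* (b :- a)) refl (f 0) (f 1)
  consecutive (suc t) st≤L with consecutive t (ℕₚ.<⇒≤ st≤L)
  ... | ft≡ , fst≡ = fst≡ , (begin
    f (suc (suc t))                                   ≡⟨ solve 2 (λ a c → c := (a :+ c) :- a) refl (f t) (f (suc (suc t))) ⟩
    f t + f (suc (suc t)) - f t                       ≡˘⟨ cong (_- f t) (harmonic t st≤L) ⟩
    fromℕ 2 · f (suc t) - f t                         ≡⟨ cong₂ (λ a b → fromℕ 2 · a - b) fst≡ ft≡ ⟩
    fromℕ 2 · φ (suc t) - φ t                         ≡⟨ cong (λ a → fromℕ 2 · (f 0 + a · s) - φ t) (fromℕ-suc t) ⟩
    fromℕ 2 · (f 0 + (1ℚ + x) · s) - (f 0 + x · s)    ≡⟨ solve 3 (λ a s x → con (fromℕ 2) :* (a :+ (con 1ℚ :+ x) :* s) :- (a :+ x :* s) := a :+ (con 1ℚ :+ (con 1ℚ :+ x)) :* s) refl (f 0) s x ⟩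
    f 0 + (1ℚ + (1ℚ + x)) · s                         ≡˘⟨ cong (λ a → f 0 + a · s) (fromℕ-2+ t) ⟩
    φ (suc (suc t))                                   ∎)
    where
    s x : ℚ
    s = f 1 - f 0
    x = fromℕ t
  affine : ∀ t → t ≤ suc L → f t ≡ φ t
  affine zero    _         = proj₁ (consecutive 0 z≤n)
  affine (suc t) (s≤s t≤L) = proj₂ (consecutive t t≤L)

-- A function harmonic off a pole y, along the cycle through y: d is its value at the hub,
-- δ and ε its slopes on the arcs of Q and R + 1 edges from the hub to y and from y back.
arcs-vanish : ∀ {d δ ε} (Q R : ℕ) → d + fromℕ Q · δ ≡ 0ℚ → (d + δ) + fromℕ R · ε ≡ d + d → fromℕ (suc R) · ε ≡ d →
              d ≡ 0ℚ × δ ≡ 0ℚ × ε ≡ 0ℚ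
arcs-vanish {d} {δ} {ε} Q R left hub right = d≡0 , δ≡0 , trans (sym δ≡ε) δ≡0
  where
  q r : ℚ
  q = fromℕ Q
  r = fromℕ R
  right′ : (1ℚ + r) · ε - d ≡ 0ℚ
  right′ = trans (cong (λ x → x · ε - d) (sym (fromℕ-suc R))) (trans (cong (_- d) right) (ℚₚ.+-inverseʳ d))
  hub′ : (d + δ) + r · ε - (d + d) ≡ 0ℚ
  hub′ = trans (cong (_- (d + d)) hub) (ℚₚ.+-inverseʳ (d + d))
  δ≡ε : δ ≡ ε
  δ≡ε = p-q≡0⇒p≡q δ ε (begin
    δ - ε                                                        ≡⟨ solve 4 (λ d δ ε r → δ :- ε := ((d :+ δ) :+ r :* ε :- (d :+ d)) :- ((con 1ℚ :+ r) :* ε :- d)) refl d δ ε r ⟩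
    ((d + δ) + r · ε - (d + d)) - ((1ℚ + r) · ε - d)             ≡⟨ cong₂ _-_ hub′ right′ ⟩
    0ℚ - 0ℚ                                                      ≡⟨ refl ⟩
    0ℚ                                                           ∎)
  δ≡0 : δ ≡ 0ℚ
  δ≡0 = fromℕ-suc·p≡0⇒p≡0 (R ℕ.+ Q) δ (begin
    fromℕ (suc (R ℕ.+ Q)) · δ                                    ≡⟨ cong (_· δ) (trans (fromℕ-suc (R ℕ.+ Q)) (cong (_+_ 1ℚ) (fromℕ-+ R Q))) ⟩
    (1ℚ + (r + q)) · δ                                           ≡⟨ solve 5 (λ d δ ε r q → (con 1ℚ :+ (r :+ q)) :* δ := (d :+ q :* δ) :+ ((con 1ℚ :+ r) :* ε :- d) :+ (con 1ℚ :+ r) :* (δ :- ε)) refl d δ ε r q ⟩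
    (d + q · δ) + ((1ℚ + r) · ε - d) + (1ℚ + r) · (δ - ε)        ≡⟨ cong₂ (λ a b → a + b + (1ℚ + r) · (δ - ε)) left right′ ⟩
    0ℚ + 0ℚ + (1ℚ + r) · (δ - ε)                                 ≡⟨ cong (λ x → 0ℚ + 0ℚ + (1ℚ + r) · (δ - x)) (sym δ≡ε) ⟩
    0ℚ + 0ℚ + (1ℚ + r) · (δ - δ)                                 ≡⟨ solve 2 (λ r δ → con 0ℚ :+ con 0ℚ :+ (con 1ℚ :+ r) :* (δ :- δ) := con 0ℚ) refl r δ ⟩
    0ℚ                                                           ∎)
  d≡0 : d ≡ 0ℚ
  d≡0 = begin
    d                     ≡˘⟨ right ⟩
    fromℕ (suc R) · ε     ≡⟨ cong (fromℕ (suc R) ·_) (trans (sym δ≡ε) δ≡0) ⟩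
    fromℕ (suc R) · 0ℚ    ≡⟨ ℚₚ.*-zeroʳ (fromℕ (suc R)) ⟩
    0ℚ                    ∎

⌊⌋-yes : {P : Set} (d : Dec P) → P → ⌊ d ⌋ ≡ true
⌊⌋-yes d p = trans (isYes≗does d) (dec-true d p)

⌊⌋-no : {P : Set} (d : Dec P) → ¬ P → ⌊ d ⌋ ≡ false
⌊⌋-no d ¬p = trans (isYes≗does d) (dec-false d ¬p)

-- The graph PW(n, k)

module Pinwheel (n-3 k-1 : ℕ) where

  n-1 : ℕ
  n-1 = suc (suc n-3)

  n : ℕ
  n = suc n-1

  k : ℕ
  k = suc k-1

  open FinGraph (PW n k) using (V; verts; adj)
  open Walk (PW n k)

  hub : V
  hub = inj₁ tt

  -- (c , j) sits at position pos j on the c-th cycle; the hub is at positions 0 and n of every cycle.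
  pos : Fin n-1 → ℕ
  pos j = suc (toℕ j)

  vertexAt : Fin k → ℕ → V
  vertexAt c zero = hub
  vertexAt c (suc p) with p ℕ.<? n-1
  ... | yes p<n-1 = inj₂ (c , Fin.fromℕ< p<n-1)
  ... | no _      = hub

  vertexAt-pos : ∀ c j → vertexAt c (pos j) ≡ inj₂ (c , j)
  vertexAt-pos c j with toℕ j ℕ.<? n-1
  ... | yes j<n-1 = cong (λ i → inj₂ (c , i)) (Finₚ.fromℕ<-toℕ j j<n-1)
  ... | no j≮n-1  = ⊥-elim (j≮n-1 (Finₚ.toℕ<n j))

  vertexAt-n : ∀ c → vertexAt c n ≡ hub
  vertexAt-n c with n-1 ℕ.<? n-1
  ... | yes n-1<n-1 = ⊥-elim (ℕₚ.<-irrefl refl n-1<n-1)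
  ... | no _        = refl

  vertexAt-suc : ∀ c {t} (t<n-1 : t < n-1) → vertexAt c (suc t) ≡ inj₂ (c , Fin.fromℕ< t<n-1)
  vertexAt-suc c t<n-1 = subst (λ p → vertexAt c (suc p) ≡ inj₂ (c , Fin.fromℕ< t<n-1)) (Finₚ.toℕ-fromℕ< t<n-1) (vertexAt-pos c (Fin.fromℕ< t<n-1))

  vertexAt≡inj₂ : ∀ {c c′ j} p → vertexAt c (suc p) ≡ inj₂ (c′ , j) → c ≡ c′ × suc p ≡ pos j
  vertexAt≡inj₂ {c} p eq with p ℕ.<? n-1 | eq
  ... | yes p<n-1 | refl = refl , cong suc (sym (Finₚ.toℕ-fromℕ< p<n-1))
  ... | no _      | ()

  pos≤n-1 : ∀ j → pos j ≤ n-1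
  pos≤n-1 j = Finₚ.toℕ<n j

  vertexAt-suc≢hub : ∀ c {t} → t < n-1 → vertexAt c (suc t) ≢ hub
  vertexAt-suc≢hub c t<n-1 eq with trans (sym (vertexAt-suc c t<n-1)) eq
  ... | ()

  ∑V-split : ∀ f → ∑ verts f ≡ f hub + ∑ (allFin k) (λ c → ∑ (allFin n-1) (λ j → f (inj₂ (c , j))))
  ∑V-split f = cong (_+_ (f hub)) (begin
    ∑ (map inj₂ (cartesianProduct (allFin k) (allFin n-1))) f       ≡⟨ ∑-map inj₂ (cartesianProduct (allFin k) (allFin n-1)) f ⟩
    ∑ (cartesianProduct (allFin k) (allFin n-1)) (f ∘ inj₂)        ≡⟨ ∑-cartesianProduct (allFin k) (allFin n-1) (f ∘ inj₂) ⟩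
    ∑ (allFin k) (λ c → ∑ (allFin n-1) (λ j → f (inj₂ (c , j))))   ∎)

  verts-enumerates : Enumerates verts
  verts-enumerates = (hub∉ ∷ Uniqueₚ.map⁺ inj₂-injective (Uniqueₚ.cartesianProduct⁺ (Uniqueₚ.allFin⁺ k) (Uniqueₚ.allFin⁺ n-1))) , complete
    where
    hub∉ : All (hub ≢_) (map inj₂ (cartesianProduct (allFin k) (allFin n-1)))
    hub∉ = Allₚ.map⁺ (All.universal (λ _ ()) _)
    complete : ∀ v → v ∈ verts
    complete (inj₁ tt)      = here refl
    complete (inj₂ (c , j)) = there (∈-map⁺ inj₂ (∈-cartesianProduct⁺ (∈-allFin c) (∈-allFin j)))

  ⌊≟⌋-sym : (c c′ : Fin k) → ⌊ c Fin.≟ c′ ⌋ ≡ ⌊ c′ Fin.≟ c ⌋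
  ⌊≟⌋-sym c c′ with c Fin.≟ c′
  ... | yes c≡c′ = sym (⌊⌋-yes (c′ Fin.≟ c) (sym c≡c′))
  ... | no c≢c′  = sym (⌊⌋-no (c′ Fin.≟ c) (c≢c′ ∘ sym))

  adj-sym : ∀ v w → adj v w ≡ adj w v
  adj-sym (inj₁ _)       (inj₁ _)         = refl
  adj-sym (inj₁ _)       (inj₂ _)         = refl
  adj-sym (inj₂ _)       (inj₁ _)         = refl
  adj-sym (inj₂ (c , j)) (inj₂ (c′ , j′)) =
    cong₂ _∧_ (⌊≟⌋-sym c c′) (Boolₚ.∨-comm (suc (toℕ j) == toℕ j′) (suc (toℕ j′) == toℕ j))

  consecutive-adjacent : ∀ c p → p < n → adj (vertexAt c p) (vertexAt c (suc p)) ≡ true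
  consecutive-adjacent c zero _ = cong (adj hub) (vertexAt-pos c Fin.zero)
  consecutive-adjacent c (suc t) (s≤s t<n-1) with ℕₚ.m≤n⇒m<n∨m≡n t<n-1
  ... | inj₁ st<n-1 = begin
    adj (vertexAt c (suc t)) (vertexAt c (suc (suc t)))                      ≡⟨ cong₂ adj (vertexAt-suc c t<n-1) (vertexAt-suc c st<n-1) ⟩
    ⌊ c Fin.≟ c ⌋ ∧ ((suc (toℕ j) == toℕ j′) ∨ (suc (toℕ j′) == toℕ j))     ≡⟨ cong₂ (λ a b → a ∧ (b ∨ (suc (toℕ j′) == toℕ j))) (⌊⌋-yes (c Fin.≟ c) refl) (⌊⌋-yes (suc (toℕ j) ℕ.≟ toℕ j′) successor) ⟩
    true                                                                     ∎
    where
    j j′ : Fin n-1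
    j  = Fin.fromℕ< t<n-1
    j′ = Fin.fromℕ< st<n-1
    successor : suc (toℕ j) ≡ toℕ j′
    successor = trans (cong suc (Finₚ.toℕ-fromℕ< t<n-1)) (sym (Finₚ.toℕ-fromℕ< st<n-1))
  ... | inj₂ st≡n-1 = begin
    adj (vertexAt c (suc t)) (vertexAt c (suc (suc t)))              ≡⟨ cong₂ adj (vertexAt-suc c t<n-1) (trans (cong (vertexAt c ∘ suc) st≡n-1) (vertexAt-n c)) ⟩
    (toℕ j == 0) ∨ (suc (toℕ j) == n-1)                              ≡⟨ cong ((toℕ j == 0) ∨_) (⌊⌋-yes (suc (toℕ j) ℕ.≟ n-1) (trans (cong suc (Finₚ.toℕ-fromℕ< t<n-1)) st≡n-1)) ⟩
    (toℕ j == 0) ∨ true                                              ≡⟨ Boolₚ.∨-zeroʳ (toℕ j == 0) ⟩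
    true                                                             ∎
    where
    j : Fin n-1
    j = Fin.fromℕ< t<n-1

  adjacent-prev : ∀ c j → adj (inj₂ (c , j)) (vertexAt c (toℕ j)) ≡ true
  adjacent-prev c j = begin
    adj (inj₂ (c , j)) (vertexAt c (toℕ j))          ≡˘⟨ cong (λ v → adj v (vertexAt c (toℕ j))) (vertexAt-pos c j) ⟩
    adj (vertexAt c (pos j)) (vertexAt c (toℕ j))    ≡⟨ adj-sym (vertexAt c (pos j)) (vertexAt c (toℕ j)) ⟩
    adj (vertexAt c (toℕ j)) (vertexAt c (pos j))    ≡⟨ consecutive-adjacent c (toℕ j) (ℕₚ.m<n⇒m<1+n (Finₚ.toℕ<n j)) ⟩
    true                                             ∎

  adjacent-next : ∀ c j → adj (inj₂ (c , j)) (vertexAt c (suc (pos j))) ≡ true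
  adjacent-next c j = trans (cong (λ v → adj v (vertexAt c (suc (pos j)))) (sym (vertexAt-pos c j)))
                            (consecutive-adjacent c (pos j) (s≤s (Finₚ.toℕ<n j)))

  nonadjacent-inner : ∀ c j w → w ≢ vertexAt c (toℕ j) → w ≢ vertexAt c (suc (pos j)) → adj (inj₂ (c , j)) w ≡ false
  nonadjacent-inner c j (inj₁ tt) w≢prev w≢next =
    cong₂ _∨_ (⌊⌋-no (toℕ j ℕ.≟ 0) (λ j≡0 → w≢prev (sym (cong (vertexAt c) j≡0))))
              (⌊⌋-no (suc (toℕ j) ℕ.≟ n-1) (λ sj≡n-1 → w≢next (sym (trans (cong (vertexAt c ∘ suc) sj≡n-1) (vertexAt-n c)))))
  nonadjacent-inner c j (inj₂ (c′ , j′)) w≢prev w≢next with c Fin.≟ c′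
  ... | no _     = refl
  ... | yes refl =
    cong₂ _∨_ (⌊⌋-no (suc (toℕ j) ℕ.≟ toℕ j′) (λ e → w≢next (sym (trans (cong (vertexAt c ∘ suc) e) (vertexAt-pos c j′)))))
              (⌊⌋-no (suc (toℕ j′) ℕ.≟ toℕ j) (λ e → w≢prev (sym (trans (cong (vertexAt c) (sym e)) (vertexAt-pos c j′)))))

  prev≢next : ∀ c j → vertexAt c (toℕ j) ≢ vertexAt c (suc (pos j))
  prev≢next c Fin.zero eq with trans eq (vertexAt-suc c {1} (s≤s (s≤s z≤n)))
  ... | ()
  prev≢next c (Fin.suc i) eq = ℕₚ.m≢1+n+m (toℕ i) {1} (sym (begin
    suc (suc (toℕ i))                         ≡⟨ ℕₚ.suc-injective (proj₂ (vertexAt≡inj₂ (suc (suc (toℕ i))) (trans (sym eq) (vertexAt-suc c i<n-1)))) ⟩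
    toℕ (Fin.fromℕ< i<n-1)                    ≡⟨ Finₚ.toℕ-fromℕ< i<n-1 ⟩
    toℕ i                                     ∎))
    where
    i<n-1 : toℕ i < n-1
    i<n-1 = ℕₚ.m<n⇒m<1+n (Finₚ.toℕ<n i)

  neighbourSum-inner : ∀ c j F → neighbourSum (inj₂ (c , j)) F ≡ F (vertexAt c (toℕ j)) + F (vertexAt c (suc (pos j)))
  neighbourSum-inner c j F = trans (∑-pair verts-enumerates (prev≢next c j) outside)
    (cong₂ _+_ (cong (λ b → if b then F (vertexAt c (toℕ j)) else 0ℚ) (adjacent-prev c j))
               (cong (λ b → if b then F (vertexAt c (suc (pos j))) else 0ℚ) (adjacent-next c j)))
    where
    outside : ∀ w → w ≢ vertexAt c (toℕ j) → w ≢ vertexAt c (suc (pos j)) → (if adj (inj₂ (c , j)) w then F w else 0ℚ) ≡ 0ℚ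
    outside w w≢prev w≢next = cong (λ b → if b then F w else 0ℚ) (nonadjacent-inner c j w w≢prev w≢next)

  last : Fin n-1
  last = Fin.fromℕ (suc n-3)

  pos-last : pos last ≡ n-1
  pos-last = cong suc (Finₚ.toℕ-fromℕ (suc n-3))

  endPos-false : ∀ j → j ≢ Fin.zero → j ≢ last → endPos n j ≡ false
  endPos-false j j≢0 j≢last =
    cong₂ _∨_ (⌊⌋-no (toℕ j ℕ.≟ 0) (λ e → j≢0 (Finₚ.toℕ-injective e)))
              (⌊⌋-no (pos j ℕ.≟ n-1) (λ e → j≢last (Finₚ.toℕ-injective (ℕₚ.suc-injective (trans e (sym pos-last))))))

  endPos-last : endPos n last ≡ true
  endPos-last = trans (cong ((toℕ last == 0) ∨_) (⌊⌋-yes (pos last ℕ.≟ n-1) pos-last)) (Boolₚ.∨-zeroʳ (toℕ last == 0))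

  neighbourSum-hub : ∀ F → neighbourSum hub F ≡ ∑ (allFin k) (λ c → F (vertexAt c 1) + F (vertexAt c n-1))
  neighbourSum-hub F = begin
    neighbourSum hub F                                                                        ≡⟨ ∑V-split (λ w → if adj hub w then F w else 0ℚ) ⟩
    0ℚ + ∑ (allFin k) (λ c → ∑ (allFin n-1) (λ j → if endPos n j then F (inj₂ (c , j)) else 0ℚ)) ≡⟨ ℚₚ.+-identityˡ _ ⟩
    ∑ (allFin k) (λ c → ∑ (allFin n-1) (λ j → if endPos n j then F (inj₂ (c , j)) else 0ℚ))      ≡⟨ ∑-cong (allFin k) ends ⟩
    ∑ (allFin k) (λ c → F (vertexAt c 1) + F (vertexAt c n-1))                                 ∎
    where
    ends : ∀ c → ∑ (allFin n-1) (λ j → if endPos n j then F (inj₂ (c , j)) else 0ℚ) ≡ F (vertexAt c 1) + F (vertexAt c n-1)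
    ends c = begin
      ∑ (allFin n-1) (λ j → if endPos n j then F (inj₂ (c , j)) else 0ℚ)   ≡⟨ ∑-pair (allFin-enumerates n-1) (λ ()) (λ j j≢0 j≢last → cong (λ b → if b then F (inj₂ (c , j)) else 0ℚ) (endPos-false j j≢0 j≢last)) ⟩
      F (inj₂ (c , Fin.zero)) + (if endPos n last then F (inj₂ (c , last)) else 0ℚ) ≡⟨ cong₂ _+_ (cong F (sym (vertexAt-pos c Fin.zero))) (cong (λ b → if b then F (inj₂ (c , last)) else 0ℚ) endPos-last) ⟩
      F (vertexAt c 1) + F (inj₂ (c , last))                              ≡˘⟨ cong (λ p → F (vertexAt c 1) + F p) (trans (cong (vertexAt c) (sym pos-last)) (vertexAt-pos c last)) ⟩
      F (vertexAt c 1) + F (vertexAt c n-1)                               ∎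

  deg-inner : ∀ c j → deg (inj₂ (c , j)) ≡ 2
  deg-inner c j = fromℕ-injective (trans (fromℕ-deg (inj₂ (c , j))) (neighbourSum-inner c j (λ _ → 1ℚ)))

  deg-hub : deg hub ≡ k ℕ.* 2
  deg-hub = fromℕ-injective (begin
    fromℕ (deg hub)                                   ≡⟨ fromℕ-deg hub ⟩
    neighbourSum hub (λ _ → 1ℚ)                       ≡⟨ neighbourSum-hub (λ _ → 1ℚ) ⟩
    ∑ (allFin k) (λ _ → 1ℚ + 1ℚ)                      ≡⟨ ∑-allFin-const k (1ℚ + 1ℚ) ⟩
    fromℕ k · fromℕ 2                                 ≡˘⟨ fromℕ-* k 2 ⟩
    fromℕ (k ℕ.* 2)                                   ∎)

  fromℕ-deg-hub : fromℕ (deg hub) ≡ fromℕ k · fromℕ 2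
  fromℕ-deg-hub = trans (cong fromℕ deg-hub) (fromℕ-* k 2)

  deg≢0 : ∀ v → deg v ≢ 0
  deg≢0 (inj₁ tt)      eq = ℕₚ.1+n≢0 (trans (sym deg-hub) eq)
  deg≢0 (inj₂ (c , j)) eq = ℕₚ.1+n≢0 (trans (sym (deg-inner c j)) eq)

  open Undirected verts-enumerates adj-sym deg≢0

  -- Functions harmonic off one vertex

  module ArcProfile (D : V → ℚ) {y : V} (D-harmonic : ∀ x → x ≢ y → HarmonicAt x D) where

    profile : Fin k → ℕ → ℚ
    profile c p = D (vertexAt c p)

    profile-harmonic : ∀ c {t} → t < n-1 → vertexAt c (suc t) ≢ y →
                       fromℕ 2 · profile c (suc t) ≡ profile c t + profile c (suc (suc t))
    profile-harmonic c {t} t<n-1 ≢y = begin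
      fromℕ 2 · D (vertexAt c (suc t))                          ≡⟨ cong (λ v → fromℕ 2 · D v) (vertexAt-suc c t<n-1) ⟩
      fromℕ 2 · D x                                             ≡˘⟨ cong (λ d → fromℕ d · D x) (deg-inner c j) ⟩
      fromℕ (deg x) · D x                                       ≡⟨ harmonic⇒neighbourSum x D (D-harmonic x (≢y ∘ trans (vertexAt-suc c t<n-1))) ⟩
      neighbourSum x D                                          ≡⟨ neighbourSum-inner c j D ⟩
      D (vertexAt c (toℕ j)) + D (vertexAt c (suc (pos j)))     ≡⟨ cong (λ p → D (vertexAt c p) + D (vertexAt c (suc (suc p)))) (Finₚ.toℕ-fromℕ< t<n-1) ⟩
      D (vertexAt c t) + D (vertexAt c (suc (suc t)))           ∎
      where
      j : Fin n-1
      j = Fin.fromℕ< t<n-1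
      x : V
      x = inj₂ (c , j)

    profile-affine : ∀ c L → L ≤ n-1 → (∀ s → s < L → vertexAt c (suc s) ≢ y) →
                     ∀ t → t ≤ suc L → profile c t ≡ D hub + fromℕ t · (profile c 1 - D hub)
    profile-affine c L L≤n-1 avoids =
      affine-on-path (profile c) L (λ s s<L → profile-harmonic c (ℕₚ.<-≤-trans s<L L≤n-1) (avoids s s<L))

    profile-constant : ∀ c → (∀ s → s < n-1 → vertexAt c (suc s) ≢ y) → ∀ p → p ≤ n → profile c p ≡ D hub
    profile-constant c avoids p p≤n = begin
      profile c p                    ≡⟨ affine p p≤n ⟩
      D hub + fromℕ p · slope        ≡⟨ cong (λ s → D hub + fromℕ p · s) slope≡0 ⟩
      D hub + fromℕ p · 0ℚ           ≡⟨ solve 2 (λ a p → a :+ p :* con 0ℚ := a) refl (D hub) (fromℕ p) ⟩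
      D hub                          ∎
      where
      slope : ℚ
      slope = profile c 1 - D hub
      affine : ∀ t → t ≤ n → profile c t ≡ D hub + fromℕ t · slope
      affine = profile-affine c n-1 ℕₚ.≤-refl avoids
      slope≡0 : slope ≡ 0ℚ
      slope≡0 = fromℕ-suc·p≡0⇒p≡0 n-1 slope (begin
        fromℕ n · slope                     ≡⟨ solve 3 (λ a n s → n :* s := a :+ n :* s :- a) refl (D hub) (fromℕ n) slope ⟩
        D hub + fromℕ n · slope - D hub     ≡˘⟨ cong (_- D hub) (affine n ℕₚ.≤-refl) ⟩
        profile c n - D hub                 ≡⟨ cong (λ v → D v - D hub) (vertexAt-n c) ⟩
        D hub - D hub                       ≡⟨ ℚₚ.+-inverseʳ (D hub) ⟩
        0ℚ                                  ∎)

  module Pole (c : Fin k) (q : Fin n-1) (D : V → ℚ) (D-pole : D (inj₂ (c , q)) ≡ 0ℚ)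
              (D-harmonic : ∀ x → x ≢ inj₂ (c , q) → HarmonicAt x D) where

    open ArcProfile D D-harmonic

    Q R : ℕ
    Q = pos q
    R = n-1 ∸ Q

    R+Q≡n-1 : R ℕ.+ Q ≡ n-1
    R+Q≡n-1 = ℕₚ.m∸n+n≡m (pos≤n-1 q)

    d δ ε : ℚ
    d = D hub
    δ = profile c 1 - d
    ε = profile c (suc Q) - profile c Q

    profile-Q : profile c Q ≡ 0ℚ
    profile-Q = trans (cong D (vertexAt-pos c q)) D-pole

    other-cycles : ∀ c′ → c′ ≢ c → ∀ p → p ≤ n → profile c′ p ≡ d
    other-cycles c′ c′≢c = profile-constant c′ (λ s _ eq → c′≢c (proj₁ (vertexAt≡inj₂ s eq)))

    near-arc : ∀ t → t ≤ Q → profile c t ≡ d + fromℕ t · δ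
    near-arc = profile-affine c (toℕ q) (ℕₚ.<⇒≤ (pos≤n-1 q))
                 (λ s s<q eq → ℕₚ.<⇒≢ s<q (ℕₚ.suc-injective (proj₂ (vertexAt≡inj₂ s eq))))

    far-arc : ∀ s → s ≤ suc R → profile c (s ℕ.+ Q) ≡ fromℕ s · ε
    far-arc s s≤1+R = begin
      profile c (s ℕ.+ Q)                 ≡⟨ affine-on-path (λ s → profile c (s ℕ.+ Q)) R harmonic s s≤1+R ⟩
      profile c Q + fromℕ s · ε           ≡⟨ cong (λ a → a + fromℕ s · ε) profile-Q ⟩
      0ℚ + fromℕ s · ε                    ≡⟨ ℚₚ.+-identityˡ (fromℕ s · ε) ⟩
      fromℕ s · ε                         ∎
      where
      harmonic : ∀ s → s < R → fromℕ 2 · profile c (suc s ℕ.+ Q) ≡ profile c (s ℕ.+ Q) + profile c (suc (suc s) ℕ.+ Q)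
      harmonic s s<R = profile-harmonic c (subst (s ℕ.+ Q <_) R+Q≡n-1 (ℕₚ.+-monoˡ-< Q s<R))
                                          (λ eq → ℕₚ.m≢1+n+m Q (sym (proj₂ (vertexAt≡inj₂ (s ℕ.+ Q) eq))))

    boundary-near : d + fromℕ Q · δ ≡ 0ℚ
    boundary-near = trans (sym (near-arc Q ℕₚ.≤-refl)) profile-Q

    boundary-far : fromℕ (suc R) · ε ≡ d
    boundary-far = begin
      fromℕ (suc R) · ε              ≡˘⟨ far-arc (suc R) ℕₚ.≤-refl ⟩
      profile c (suc (R ℕ.+ Q))      ≡⟨ cong (profile c ∘ suc) R+Q≡n-1 ⟩
      profile c n                    ≡⟨ cong D (vertexAt-n c) ⟩
      d                              ∎

    -- The other cycles contribute d + d each to the neighbour sum of the hub.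
    hub-balance : (d + δ) + fromℕ R · ε ≡ d + d
    hub-balance = begin
      (d + δ) + fromℕ R · ε          ≡˘⟨ cong₂ _+_ (trans (near-arc 1 (s≤s z≤n)) (cong (_+_ d) (ℚₚ.*-identityˡ δ)))
                                                   (trans (cong (profile c) (sym R+Q≡n-1)) (far-arc R (ℕₚ.n≤1+n R))) ⟩
      profile c 1 + profile c n-1    ≡⟨ p-q≡0⇒p≡q (profile c 1 + profile c n-1) (d + d) (+-identityʳ-unique (fromℕ k · (d + d)) excess (sym neighbours)) ⟩
      d + d                          ∎
      where
      excess : ℚ
      excess = (profile c 1 + profile c n-1) - (d + d)
      neighbours : fromℕ k · (d + d) ≡ fromℕ k · (d + d) + excess
      neighbours = begin
        fromℕ k · (d + d)                                        ≡⟨ solve 2 (λ k d → k :* (d :+ d) := k :* (con 1ℚ :+ con 1ℚ) :* d) refl (fromℕ k) d ⟩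
        fromℕ k · fromℕ 2 · d                                    ≡˘⟨ cong (_· d) fromℕ-deg-hub ⟩
        fromℕ (deg hub) · d                                      ≡⟨ harmonic⇒neighbourSum hub D (D-harmonic hub (λ ())) ⟩
        neighbourSum hub D                                       ≡⟨ neighbourSum-hub D ⟩
        ∑ (allFin k) (λ c′ → profile c′ 1 + profile c′ n-1)      ≡⟨ ∑-allFin-except k (λ c′ c′≢c → cong₂ _+_ (other-cycles c′ c′≢c 1 (s≤s z≤n)) (other-cycles c′ c′≢c n-1 (ℕₚ.n≤1+n n-1))) ⟩
        fromℕ k · (d + d) + excess                               ∎

    arcs-zero : d ≡ 0ℚ × δ ≡ 0ℚ × ε ≡ 0ℚ
    arcs-zero = arcs-vanish Q R boundary-near hub-balance boundary-far

    on-cycle : ∀ p → p ≤ n-1 → profile c p ≡ 0ℚ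
    on-cycle p p≤n-1 with p ℕ.≤? Q
    ... | yes p≤Q = begin
      profile c p                    ≡⟨ near-arc p p≤Q ⟩
      d + fromℕ p · δ                ≡⟨ cong₂ (λ a b → a + fromℕ p · b) (proj₁ arcs-zero) (proj₁ (proj₂ arcs-zero)) ⟩
      0ℚ + fromℕ p · 0ℚ              ≡⟨ solve 1 (λ p → con 0ℚ :+ p :* con 0ℚ := con 0ℚ) refl (fromℕ p) ⟩
      0ℚ                             ∎
    ... | no p≰Q = begin
      profile c p                    ≡˘⟨ cong (profile c) (ℕₚ.m∸n+n≡m Q≤p) ⟩
      profile c (p ∸ Q ℕ.+ Q)        ≡⟨ far-arc (p ∸ Q) (ℕₚ.m≤n⇒m≤1+n (ℕₚ.∸-monoˡ-≤ Q p≤n-1)) ⟩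
      fromℕ (p ∸ Q) · ε              ≡⟨ cong (fromℕ (p ∸ Q) ·_) (proj₂ (proj₂ arcs-zero)) ⟩
      fromℕ (p ∸ Q) · 0ℚ             ≡⟨ ℚₚ.*-zeroʳ (fromℕ (p ∸ Q)) ⟩
      0ℚ                             ∎
      where
      Q≤p : Q ≤ p
      Q≤p = ℕₚ.<⇒≤ (ℕₚ.≰⇒> p≰Q)

    vanish : ∀ x → D x ≡ 0ℚ
    vanish (inj₁ tt) = proj₁ arcs-zero
    vanish (inj₂ (c′ , j)) with c′ Fin.≟ c
    ... | yes refl = trans (cong D (sym (vertexAt-pos c j))) (on-cycle (pos j) (pos≤n-1 j))
    ... | no c′≢c  = trans (cong D (sym (vertexAt-pos c′ j))) (trans (other-cycles c′ c′≢c (pos j) (ℕₚ.m≤n⇒m≤1+n (pos≤n-1 j))) (proj₁ arcs-zero))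

  dirichlet : DirichletUniqueness
  dirichlet (inj₁ tt)      D D-hub  D-harmonic = vanish
    where
    open ArcProfile D D-harmonic
    vanish : ∀ x → D x ≡ 0ℚ
    vanish (inj₁ tt)      = D-hub
    vanish (inj₂ (c , j)) = begin
      D (inj₂ (c , j))    ≡˘⟨ cong D (vertexAt-pos c j) ⟩
      profile c (pos j)   ≡⟨ profile-constant c (λ s s<n-1 → vertexAt-suc≢hub c s<n-1) (pos j) (ℕₚ.m≤n⇒m≤1+n (pos≤n-1 j)) ⟩
      D hub               ≡⟨ D-hub ⟩
      0ℚ                  ∎
  dirichlet (inj₂ (c , q)) D D-pole D-harmonic = Pole.vanish c q D D-pole D-harmonic

  -- An explicit hitting-time matrix

  nℚ twoK : ℚ
  nℚ   = fromℕ n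
  twoK = fromℕ 2 · fromℕ k

  -- Gambler's ruin: the expected time to reach the hub from position P of a cycle.
  hubTime : ℕ → ℚ
  hubTime P = fromℕ P · (nℚ - fromℕ P)

  -- Green's function of the walk on the positions 0, …, n of a cycle, killed at both ends.
  green : ℕ → ℕ → ℚ
  green P Q = fromℕ (P ℕ.⊓ Q) · (nℚ - fromℕ (P ℕ.⊔ Q))

  green-≤ : ∀ {P Q} → P ≤ Q → green P Q ≡ fromℕ P · (nℚ - fromℕ Q)
  green-≤ P≤Q = cong₂ (λ a b → fromℕ a · (nℚ - fromℕ b)) (ℕₚ.m≤n⇒m⊓n≡m P≤Q) (ℕₚ.m≤n⇒m⊔n≡n P≤Q)

  green-≥ : ∀ {P Q} → Q ≤ P → green P Q ≡ fromℕ Q · (nℚ - fromℕ P)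
  green-≥ Q≤P = cong₂ (λ a b → fromℕ a · (nℚ - fromℕ b)) (ℕₚ.m≥n⇒m⊓n≡n Q≤P) (ℕₚ.m≥n⇒m⊔n≡m Q≤P)

  hubTime-second-difference : ∀ t → fromℕ 2 · hubTime (suc t) ≡ fromℕ 2 + (hubTime t + hubTime (suc (suc t)))
  hubTime-second-difference t = begin
    fromℕ 2 · (fromℕ (suc t) · (nℚ - fromℕ (suc t)))           ≡⟨ cong (λ s → fromℕ 2 · (s · (nℚ - s))) (fromℕ-suc t) ⟩
    fromℕ 2 · ((1ℚ + x) · (nℚ - (1ℚ + x)))                      ≡⟨ solve 2 (λ x n → con (fromℕ 2) :* ((con 1ℚ :+ x) :* (n :- (con 1ℚ :+ x)))
                                                                       := con (fromℕ 2) :+ (x :* (n :- x) :+ (con 1ℚ :+ (con 1ℚ :+ x)) :* (n :- (con 1ℚ :+ (con 1ℚ :+ x))))) refl x nℚ ⟩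
    fromℕ 2 + (hubTime t + (1ℚ + (1ℚ + x)) · (nℚ - (1ℚ + (1ℚ + x)))) ≡˘⟨ cong (λ s → fromℕ 2 + (hubTime t + s · (nℚ - s))) (fromℕ-2+ t) ⟩
    fromℕ 2 + (hubTime t + hubTime (suc (suc t)))               ∎
    where
    x : ℚ
    x = fromℕ t

  green-second-difference : ∀ t Q → suc t ≢ Q → green t Q + green (suc (suc t)) Q ≡ fromℕ 2 · green (suc t) Q
  green-second-difference t Q st≢Q with ℕₚ.<-cmp (suc t) Q
  ... | tri≈ _ st≡Q _ = ⊥-elim (st≢Q st≡Q)
  ... | tri< st<Q _ _ = begin
    green t Q + green (suc (suc t)) Q                         ≡⟨ cong₂ _+_ (green-≤ (ℕₚ.<⇒≤ (ℕₚ.<-trans (ℕₚ.n<1+n t) st<Q))) (green-≤ st<Q) ⟩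
    x · c + fromℕ (suc (suc t)) · c                           ≡⟨ cong (λ s → x · c + s · c) (fromℕ-2+ t) ⟩
    x · c + (1ℚ + (1ℚ + x)) · c                               ≡⟨ solve 2 (λ x c → x :* c :+ (con 1ℚ :+ (con 1ℚ :+ x)) :* c := con (fromℕ 2) :* ((con 1ℚ :+ x) :* c)) refl x c ⟩
    fromℕ 2 · ((1ℚ + x) · c)                                  ≡˘⟨ cong (λ s → fromℕ 2 · (s · c)) (fromℕ-suc t) ⟩
    fromℕ 2 · (fromℕ (suc t) · c)                             ≡˘⟨ cong (fromℕ 2 ·_) (green-≤ (ℕₚ.<⇒≤ st<Q)) ⟩
    fromℕ 2 · green (suc t) Q                                 ∎
    where
    x c : ℚ
    x = fromℕ t
    c = nℚ - fromℕ Q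
  ... | tri> _ _ Q<st = begin
    green t Q + green (suc (suc t)) Q                         ≡⟨ cong₂ _+_ (green-≥ Q≤t) (green-≥ (ℕₚ.≤-trans Q≤t (ℕₚ.m≤n⇒m≤1+n (ℕₚ.n≤1+n t)))) ⟩
    q · (nℚ - x) + q · (nℚ - fromℕ (suc (suc t)))             ≡⟨ cong (λ s → q · (nℚ - x) + q · (nℚ - s)) (fromℕ-2+ t) ⟩
    q · (nℚ - x) + q · (nℚ - (1ℚ + (1ℚ + x)))                 ≡⟨ solve 3 (λ q n x → q :* (n :- x) :+ q :* (n :- (con 1ℚ :+ (con 1ℚ :+ x))) := con (fromℕ 2) :* (q :* (n :- (con 1ℚ :+ x)))) refl q nℚ x ⟩
    fromℕ 2 · (q · (nℚ - (1ℚ + x)))                           ≡˘⟨ cong (λ s → fromℕ 2 · (q · (nℚ - s))) (fromℕ-suc t) ⟩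
    fromℕ 2 · (q · (nℚ - fromℕ (suc t)))                      ≡˘⟨ cong (fromℕ 2 ·_) (green-≥ (ℕₚ.<⇒≤ Q<st)) ⟩
    fromℕ 2 · green (suc t) Q                                 ∎
    where
    Q≤t : Q ≤ t
    Q≤t = ℕₚ.≤-pred Q<st
    q x : ℚ
    q = fromℕ Q
    x = fromℕ t

  sameCopy : Fin k → Fin k → ℚ
  sameCopy c′ c = if ⌊ c′ Fin.≟ c ⌋ then 1ℚ else 0ℚ

  sameCopy-refl : ∀ c → sameCopy c c ≡ 1ℚ
  sameCopy-refl c = cong (λ b → if b then 1ℚ else 0ℚ) (⌊⌋-yes (c Fin.≟ c) refl)

  sameCopy-≢ : ∀ {c′ c} → c′ ≢ c → sameCopy c′ c ≡ 0ℚ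
  sameCopy-≢ {c′} {c} c′≢c = cong (λ b → if b then 1ℚ else 0ℚ) (⌊⌋-no (c′ Fin.≟ c) c′≢c)

  -- M₀ x y for x at position P of the c′-th cycle: reach the hub, then y from the hub,
  -- less the Green's-function saving when x and y lie on the same cycle.
  hitFrom : V → Fin k → ℕ → ℚ
  hitFrom (inj₁ _)       c′ P = hubTime P
  hitFrom (inj₂ (c , q)) c′ P = (twoK - 1ℚ) · hubTime (pos q) + hubTime P - sameCopy c′ c · (twoK · green P (pos q))

  M₀ : V → V → ℚ
  M₀ (inj₁ _)        (inj₁ _)       = 0ℚ
  M₀ (inj₁ _)        (inj₂ (c , q)) = (twoK - 1ℚ) · hubTime (pos q)
  M₀ (inj₂ (c′ , j)) y              = hitFrom y c′ (pos j)

  hitFrom-at-hub : ∀ y c′ {P} → hubTime P ≡ 0ℚ → (∀ Q → Q ≤ n → green P Q ≡ 0ℚ) → hitFrom y c′ P ≡ M₀ hub y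
  hitFrom-at-hub (inj₁ _)       c′ hubTime≡0 _        = hubTime≡0
  hitFrom-at-hub (inj₂ (c , q)) c′ {P} hubTime≡0 green≡0 = begin
    A + hubTime P - sameCopy c′ c · (twoK · green P (pos q))   ≡⟨ cong₂ (λ h g → A + h - sameCopy c′ c · (twoK · g)) hubTime≡0 (green≡0 (pos q) (ℕₚ.m≤n⇒m≤1+n (Finₚ.toℕ<n q))) ⟩
    A + 0ℚ - sameCopy c′ c · (twoK · 0ℚ)                        ≡⟨ solve 3 (λ a s k → a :+ con 0ℚ :- s :* (k :* con 0ℚ) := a) refl A (sameCopy c′ c) twoK ⟩
    A                                                          ∎
    where
    A : ℚ
    A = (twoK - 1ℚ) · hubTime (pos q)

  data PositionView : ℕ → Set where
    at-0   : PositionView 0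
    at-n   : PositionView n
    at-pos : ∀ j → PositionView (pos j)

  positionView : ∀ {P} → P ≤ n → PositionView P
  positionView {zero}  _ = at-0
  positionView {suc p} (s≤s p≤n-1) with ℕₚ.m≤n⇒m<n∨m≡n p≤n-1
  ... | inj₁ p<n-1 = subst PositionView (cong suc (Finₚ.toℕ-fromℕ< p<n-1)) (at-pos (Fin.fromℕ< p<n-1))
  ... | inj₂ refl  = at-n

  M₀-at : ∀ y c′ {P} → P ≤ n → M₀ (vertexAt c′ P) y ≡ hitFrom y c′ P
  M₀-at y c′ P≤n with positionView P≤n
  ... | at-0     = sym (hitFrom-at-hub y c′ (ℚₚ.*-zeroˡ (nℚ - fromℕ 0)) (λ Q _ → ℚₚ.*-zeroˡ (nℚ - fromℕ Q)))
  ... | at-n     = trans (cong (λ v → M₀ v y) (vertexAt-n c′)) (sym (hitFrom-at-hub y c′ hubTime-n green-n))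
    where
    hubTime-n : hubTime n ≡ 0ℚ
    hubTime-n = trans (cong (nℚ ·_) (ℚₚ.+-inverseʳ nℚ)) (ℚₚ.*-zeroʳ nℚ)
    green-n : ∀ Q → Q ≤ n → green n Q ≡ 0ℚ
    green-n Q Q≤n = trans (green-≥ Q≤n) (trans (cong (fromℕ Q ·_) (ℚₚ.+-inverseʳ nℚ)) (ℚₚ.*-zeroʳ (fromℕ Q)))
  ... | at-pos j = cong (λ v → M₀ v y) (vertexAt-pos c′ j)

  hitFrom-second-difference : ∀ y c′ t → vertexAt c′ (suc t) ≢ y →
                              fromℕ 2 · hitFrom y c′ (suc t) ≡ fromℕ 2 + (hitFrom y c′ t + hitFrom y c′ (suc (suc t)))
  hitFrom-second-difference (inj₁ _)       c′ t _  = hubTime-second-difference t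
  hitFrom-second-difference (inj₂ (c , q)) c′ t ≢y = begin
    fromℕ 2 · (A + h₁ - s · (twoK · G₁))                       ≡⟨ solve 5 (λ a h s k g → con (fromℕ 2) :* (a :+ h :- s :* (k :* g)) := a :+ a :+ con (fromℕ 2) :* h :- k :* (s :* (con (fromℕ 2) :* g))) refl A h₁ s twoK G₁ ⟩
    A + A + fromℕ 2 · h₁ - twoK · (s · (fromℕ 2 · G₁))         ≡⟨ cong₂ (λ a b → A + A + a - twoK · b) (hubTime-second-difference t) (sym same-cycle) ⟩
    A + A + (fromℕ 2 + (h₀ + h₂)) - twoK · (s · (G₀ + G₂))     ≡⟨ solve 7 (λ a h₀ h₂ s k g₀ g₂ → a :+ a :+ (con (fromℕ 2) :+ (h₀ :+ h₂)) :- k :* (s :* (g₀ :+ g₂)) := con (fromℕ 2) :+ ((a :+ h₀ :- s :* (k :* g₀)) :+ (a :+ h₂ :- s :* (k :* g₂)))) refl A h₀ h₂ s twoK G₀ G₂ ⟩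
    fromℕ 2 + ((A + h₀ - s · (twoK · G₀)) + (A + h₂ - s · (twoK · G₂))) ∎
    where
    A s h₀ h₁ h₂ G₀ G₁ G₂ : ℚ
    A  = (twoK - 1ℚ) · hubTime (pos q)
    s  = sameCopy c′ c
    h₀ = hubTime t
    h₁ = hubTime (suc t)
    h₂ = hubTime (suc (suc t))
    G₀ = green t (pos q)
    G₁ = green (suc t) (pos q)
    G₂ = green (suc (suc t)) (pos q)
    same-cycle : s · (G₀ + G₂) ≡ s · (fromℕ 2 · G₁)
    same-cycle with c′ Fin.≟ c
    ... | yes refl = cong (1ℚ ·_) (green-second-difference t (pos q) (λ st≡Q → ≢y (trans (cong (vertexAt c) st≡Q) (vertexAt-pos c q))))
    ... | no _     = trans (ℚₚ.*-zeroˡ (G₀ + G₂)) (sym (ℚₚ.*-zeroˡ (fromℕ 2 · G₁)))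

  M₀-diagonal : ∀ v → M₀ v v ≡ 0ℚ
  M₀-diagonal (inj₁ _)       = refl
  M₀-diagonal (inj₂ (c , q)) = begin
    (twoK - 1ℚ) · h + h - sameCopy c c · (twoK · green (pos q) (pos q))   ≡⟨ cong₂ (λ s g → (twoK - 1ℚ) · h + h - s · (twoK · g)) (sameCopy-refl c) (green-≤ (ℕₚ.≤-refl {pos q})) ⟩
    (twoK - 1ℚ) · h + h - 1ℚ · (twoK · h)                                 ≡⟨ solve 2 (λ k h → (k :- con 1ℚ) :* h :+ h :- con 1ℚ :* (k :* h) := con 0ℚ) refl twoK h ⟩
    0ℚ                                                                    ∎
    where
    h : ℚ
    h = hubTime (pos q)

  M₀-step-inner : ∀ c′ j y → inj₂ (c′ , j) ≢ y → M₀ (inj₂ (c′ , j)) y ≡ 1ℚ + step (inj₂ (c′ , j)) (λ w → M₀ w y)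
  M₀-step-inner c′ j y x≢y = neighbourSum⇒firstStep x F (M₀ x y) (begin
    fromℕ (deg x) · hitFrom y c′ (pos j)                               ≡⟨ cong (λ d → fromℕ d · hitFrom y c′ (pos j)) (deg-inner c′ j) ⟩
    fromℕ 2 · hitFrom y c′ (pos j)                                     ≡⟨ hitFrom-second-difference y c′ (toℕ j) (λ eq → x≢y (trans (sym (vertexAt-pos c′ j)) eq)) ⟩
    fromℕ 2 + (hitFrom y c′ (toℕ j) + hitFrom y c′ (suc (pos j)))      ≡˘⟨ cong₂ (λ d s → fromℕ d + s) (deg-inner c′ j) neighbours ⟩
    fromℕ (deg x) + neighbourSum x F                                   ∎)
    where
    x : V
    x = inj₂ (c′ , j)
    F : V → ℚ
    F w = M₀ w y
    neighbours : neighbourSum x F ≡ hitFrom y c′ (toℕ j) + hitFrom y c′ (suc (pos j))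
    neighbours = trans (neighbourSum-inner c′ j F)
      (cong₂ _+_ (M₀-at y c′ (ℕₚ.m≤n⇒m≤1+n (ℕₚ.<⇒≤ (Finₚ.toℕ<n j)))) (M₀-at y c′ (s≤s (Finₚ.toℕ<n j))))

  n-1≡nℚ-1 : fromℕ n-1 ≡ nℚ - 1ℚ
  n-1≡nℚ-1 = trans (solve 1 (λ m → m := (con 1ℚ :+ m) :- con 1ℚ) refl (fromℕ n-1)) (cong (_- 1ℚ) (sym (fromℕ-suc n-1)))

  hubTime-1 : hubTime 1 ≡ nℚ - 1ℚ
  hubTime-1 = ℚₚ.*-identityˡ (nℚ - 1ℚ)

  hubTime-n-1 : hubTime n-1 ≡ nℚ - 1ℚ
  hubTime-n-1 = trans (cong (λ m → m · (nℚ - m)) n-1≡nℚ-1) (solve 1 (λ n → (n :- con 1ℚ) :* (n :- (n :- con 1ℚ)) := n :- con 1ℚ) refl nℚ)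

  green-1 : ∀ {Q} → 1 ≤ Q → green 1 Q ≡ nℚ - fromℕ Q
  green-1 {Q} 1≤Q = trans (green-≤ 1≤Q) (ℚₚ.*-identityˡ (nℚ - fromℕ Q))

  green-n-1 : ∀ {Q} → Q ≤ n-1 → green n-1 Q ≡ fromℕ Q
  green-n-1 {Q} Q≤n-1 = trans (green-≥ Q≤n-1) (trans (cong (λ m → fromℕ Q · (nℚ - m)) n-1≡nℚ-1)
                               (solve 2 (λ q n → q :* (n :- (n :- con 1ℚ)) := q) refl (fromℕ Q) nℚ))

  hitFrom-ends : ∀ c q c′ → hitFrom (inj₂ (c , q)) c′ 1 + hitFrom (inj₂ (c , q)) c′ n-1 ≡
                            ((twoK - 1ℚ) · hubTime (pos q) + (nℚ - 1ℚ)) + ((twoK - 1ℚ) · hubTime (pos q) + (nℚ - 1ℚ)) - sameCopy c′ c · (twoK · nℚ)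
  hitFrom-ends c q c′ = begin
    (A + hubTime 1 - s · (twoK · green 1 Q)) + (A + hubTime n-1 - s · (twoK · green n-1 Q))
        ≡⟨ cong₂ _+_ (cong₂ (λ h g → A + h - s · (twoK · g)) hubTime-1 (green-1 {Q} (s≤s z≤n)))
                     (cong₂ (λ h g → A + h - s · (twoK · g)) hubTime-n-1 (green-n-1 (Finₚ.toℕ<n q))) ⟩
    (A + (nℚ - 1ℚ) - s · (twoK · (nℚ - fromℕ Q))) + (A + (nℚ - 1ℚ) - s · (twoK · fromℕ Q))
        ≡⟨ solve 5 (λ a n s k q → (a :+ (n :- con 1ℚ) :- s :* (k :* (n :- q))) :+ (a :+ (n :- con 1ℚ) :- s :* (k :* q))
                                  := (a :+ (n :- con 1ℚ)) :+ (a :+ (n :- con 1ℚ)) :- s :* (k :* n)) refl A nℚ s twoK (fromℕ Q) ⟩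
    (A + (nℚ - 1ℚ)) + (A + (nℚ - 1ℚ)) - s · (twoK · nℚ) ∎
    where
    Q : ℕ
    Q = pos q
    A s : ℚ
    A = (twoK - 1ℚ) · hubTime Q
    s = sameCopy c′ c

  M₀-step-hub : ∀ c q → M₀ hub (inj₂ (c , q)) ≡ 1ℚ + step hub (λ w → M₀ w (inj₂ (c , q)))
  M₀-step-hub c q = neighbourSum⇒firstStep hub F A (begin
    fromℕ (deg hub) · A                                        ≡⟨ cong (_· A) fromℕ-deg-hub ⟩
    fromℕ k · fromℕ 2 · A                                      ≡⟨ solve 3 (λ a k n → k :* con (fromℕ 2) :* a := k :* con (fromℕ 2) :+ (k :* ((a :+ (n :- con 1ℚ)) :+ (a :+ (n :- con 1ℚ))) :+ (((a :+ (n :- con 1ℚ)) :+ (a :+ (n :- con 1ℚ)) :- con 1ℚ :* (con (fromℕ 2) :* k :* n)) :- ((a :+ (n :- con 1ℚ)) :+ (a :+ (n :- con 1ℚ)))))) refl A (fromℕ k) nℚ ⟩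
    fromℕ k · fromℕ 2 + (fromℕ k · B + (B - 1ℚ · (twoK · nℚ) - B)) ≡˘⟨ cong (λ s → fromℕ k · fromℕ 2 + (fromℕ k · B + (B - s · (twoK · nℚ) - B))) (sameCopy-refl c) ⟩
    fromℕ k · fromℕ 2 + (fromℕ k · B + (end c - B))            ≡˘⟨ cong₂ _+_ fromℕ-deg-hub neighbours ⟩
    fromℕ (deg hub) + neighbourSum hub F                       ∎)
    where
    F : V → ℚ
    F w = M₀ w (inj₂ (c , q))
    A B : ℚ
    A = (twoK - 1ℚ) · hubTime (pos q)
    B = (A + (nℚ - 1ℚ)) + (A + (nℚ - 1ℚ))
    end : Fin k → ℚ
    end c′ = B - sameCopy c′ c · (twoK · nℚ)
    neighbours : neighbourSum hub F ≡ fromℕ k · B + (end c - B)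
    neighbours = begin
      neighbourSum hub F                                        ≡⟨ neighbourSum-hub F ⟩
      ∑ (allFin k) (λ c′ → F (vertexAt c′ 1) + F (vertexAt c′ n-1)) ≡⟨ ∑-cong (allFin k) (λ c′ → trans (cong₂ _+_ (M₀-at (inj₂ (c , q)) c′ (s≤s z≤n)) (M₀-at (inj₂ (c , q)) c′ (ℕₚ.n≤1+n n-1))) (hitFrom-ends c q c′)) ⟩
      ∑ (allFin k) end                                          ≡⟨ ∑-allFin-except k (λ c′ c′≢c → trans (cong (λ s → B - s · (twoK · nℚ)) (sameCopy-≢ c′≢c)) (solve 2 (λ b x → b :- con 0ℚ :* x := b) refl B (twoK · nℚ))) ⟩
      fromℕ k · B + (end c - B)                                 ∎

  M₀-hitting : IsHittingTimes (PW n k) M₀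
  M₀-hitting = M₀-diagonal , first-step
    where
    first-step : ∀ x y → x ≢ y → M₀ x y ≡ 1ℚ + step x (λ w → M₀ w y)
    first-step (inj₁ tt)        (inj₁ tt)      x≢y = ⊥-elim (x≢y refl)
    first-step (inj₁ tt)        (inj₂ (c , q)) _   = M₀-step-hub c q
    first-step (inj₂ (c′ , j)) y               x≢y = M₀-step-inner c′ j y x≢y

  -- The row of the hub

  hubTime-sum : ∑ (allFin n-1) (λ q → hubTime (pos q)) ≡ (nℚ - 1ℚ) · nℚ · (nℚ + 1ℚ) · (+ 1 / 6)
  hubTime-sum = begin
    ∑ (allFin n-1) (λ q → hubTime (pos q))                    ≡⟨ ∑-cong (allFin n-1) (λ q → increment (toℕ q)) ⟩
    ∑ (allFin n-1) (λ q → Φ (suc (toℕ q)) - Φ (toℕ q))        ≡⟨ ∑-telescope n-1 Φ ⟩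
    Φ n-1 - Φ 0                                               ≡⟨ cong₂ _-_ (cong Ψ n-1≡nℚ-1) Φ0≡0 ⟩
    Ψ (nℚ - 1ℚ) - 0ℚ                                          ≡⟨ solve 1 (λ n → (n :- con 1ℚ) :* (con 1ℚ :+ (n :- con 1ℚ)) :* (con (fromℕ 3) :* n :- con (fromℕ 2) :* (n :- con 1ℚ) :- con 1ℚ) :* con (+ 1 / 6) :- con 0ℚ
                                                                         := (n :- con 1ℚ) :* n :* (n :+ con 1ℚ) :* con (+ 1 / 6)) refl nℚ ⟩
    (nℚ - 1ℚ) · nℚ · (nℚ + 1ℚ) · (+ 1 / 6)                    ∎
    where
    -- Φ t = Σ_{P ≤ t} P (n - P) in closed form
    Ψ : ℚ → ℚ
    Ψ x = x · (1ℚ + x) · (fromℕ 3 · nℚ - fromℕ 2 · x - 1ℚ) · (+ 1 / 6)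
    Φ : ℕ → ℚ
    Φ t = Ψ (fromℕ t)
    Φ0≡0 : Φ 0 ≡ 0ℚ
    Φ0≡0 = solve 1 (λ n → con 0ℚ :* (con 1ℚ :+ con 0ℚ) :* (con (fromℕ 3) :* n :- con (fromℕ 2) :* con 0ℚ :- con 1ℚ) :* con (+ 1 / 6) := con 0ℚ) refl nℚ
    increment : ∀ t → hubTime (suc t) ≡ Φ (suc t) - Φ t
    increment t = begin
      fromℕ (suc t) · (nℚ - fromℕ (suc t))   ≡⟨ cong (λ s → s · (nℚ - s)) (fromℕ-suc t) ⟩
      (1ℚ + x) · (nℚ - (1ℚ + x))             ≡⟨ solve 2 (λ x n → (con 1ℚ :+ x) :* (n :- (con 1ℚ :+ x)) := (con 1ℚ :+ x) :* (con 1ℚ :+ (con 1ℚ :+ x)) :* (con (fromℕ 3) :* n :- con (fromℕ 2) :* (con 1ℚ :+ x) :- con 1ℚ) :* con (+ 1 / 6) :- x :* (con 1ℚ :+ x) :* (con (fromℕ 3) :* n :- con (fromℕ 2) :* x :- con 1ℚ) :* con (+ 1 / 6)) refl x nℚ ⟩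
      (1ℚ + x) · (1ℚ + (1ℚ + x)) · (fromℕ 3 · nℚ - fromℕ 2 · (1ℚ + x) - 1ℚ) · (+ 1 / 6) - Φ t ≡˘⟨ cong (λ s → Ψ s - Φ t) (fromℕ-suc t) ⟩
      Φ (suc t) - Φ t                        ∎
      where
      x : ℚ
      x = fromℕ t

  twoM-value : fromℕ (twoM (PW n k)) ≡ twoK · nℚ
  twoM-value = begin
    fromℕ (twoM (PW n k))                                                          ≡⟨ fromℕ-sum deg verts ⟩
    ∑ verts (fromℕ ∘ deg)                                                          ≡⟨ ∑V-split (fromℕ ∘ deg) ⟩
    fromℕ (deg hub) + ∑ (allFin k) (λ c → ∑ (allFin n-1) (λ j → fromℕ (deg (inj₂ (c , j)))))
        ≡⟨ cong₂ _+_ fromℕ-deg-hub (∑-cong (allFin k) (λ c → ∑-cong (allFin n-1) (λ j → cong fromℕ (deg-inner c j)))) ⟩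
    fromℕ k · fromℕ 2 + ∑ (allFin k) (λ c → ∑ (allFin n-1) (λ j → fromℕ 2))       ≡⟨ cong (_+_ (fromℕ k · fromℕ 2)) (trans (∑-cong (allFin k) (λ c → ∑-allFin-const n-1 (fromℕ 2))) (∑-allFin-const k (fromℕ n-1 · fromℕ 2))) ⟩
    fromℕ k · fromℕ 2 + fromℕ k · (fromℕ n-1 · fromℕ 2)                             ≡⟨ cong (λ m → fromℕ k · fromℕ 2 + fromℕ k · (m · fromℕ 2)) n-1≡nℚ-1 ⟩
    fromℕ k · fromℕ 2 + fromℕ k · ((nℚ - 1ℚ) · fromℕ 2)                             ≡⟨ solve 2 (λ k n → k :* con (fromℕ 2) :+ k :* ((n :- con 1ℚ) :* con (fromℕ 2)) := con (fromℕ 2) :* k :* n) refl (fromℕ k) nℚ ⟩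
    twoK · nℚ                                                                       ∎

  hubRow : ∑ verts (λ j → M₀ hub j · π (PW n k) j) ≡ + ((2 * k ∸ 1) * (n * n ∸ 1)) / 6
  hubRow = begin
    ∑ verts (λ j → M₀ hub j · π (PW n k) j)                                         ≡⟨ ∑V-split (λ j → M₀ hub j · π (PW n k) j) ⟩
    0ℚ · π (PW n k) hub + ∑ (allFin k) (λ c → ∑ (allFin n-1) (λ q → A q · π (PW n k) (inj₂ (c , q))))
        ≡⟨ cong₂ _+_ (ℚₚ.*-zeroˡ (π (PW n k) hub)) (∑-cong (allFin k) (λ c → ∑-cong (allFin n-1) (λ q → weight c q))) ⟩
    0ℚ + ∑ (allFin k) (λ c → ∑ (allFin n-1) (λ q → w · hubTime (pos q)))           ≡⟨ ℚₚ.+-identityˡ _ ⟩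
    ∑ (allFin k) (λ c → ∑ (allFin n-1) (λ q → w · hubTime (pos q)))                 ≡⟨ ∑-cong (allFin k) (λ c → trans (∑-·ˡ (allFin n-1) w (λ q → hubTime (pos q))) (cong (w ·_) hubTime-sum)) ⟩
    ∑ (allFin k) (λ c → w · S)                                                      ≡⟨ ∑-allFin-const k (w · S) ⟩
    fromℕ k · (w · S)                                                               ≡⟨ solve 4 (λ k n R s → k :* (((con (fromℕ 2) :* k) :- con 1ℚ) :* (con (fromℕ 2) :* R) :* ((n :- con 1ℚ) :* n :* (n :+ con 1ℚ) :* s))
                                                                                                := ((con (fromℕ 2) :* k) :- con 1ℚ) :* (n :* n :- con 1ℚ) :* s :* ((con (fromℕ 2) :* k) :* n :* R)) refl (fromℕ k) nℚ R (+ 1 / 6) ⟩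
    X · (+ 1 / 6) · (twoK · nℚ · R)                                                 ≡˘⟨ cong (λ t → X · (+ 1 / 6) · (t · R)) twoM-value ⟩
    X · (+ 1 / 6) · (fromℕ (twoM (PW n k)) · R)                                     ≡⟨ cong (X · (+ 1 / 6) ·_) (fromℕ-recipℕ (PW n k) (twoM≢0 hub)) ⟩
    X · (+ 1 / 6) · 1ℚ                                                              ≡⟨ ℚₚ.*-identityʳ _ ⟩
    X · (+ 1 / 6)                                                                   ≡˘⟨ cong (_· (+ 1 / 6)) fromℕ-numerator ⟩
    fromℕ ((2 * k ∸ 1) * (n * n ∸ 1)) · (+ 1 / 6)                                   ≡˘⟨ /≡fromℕ·1/ ((2 * k ∸ 1) * (n * n ∸ 1)) 5 ⟩
    + ((2 * k ∸ 1) * (n * n ∸ 1)) / 6                                               ∎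
    where
    A : Fin n-1 → ℚ
    A q = (twoK - 1ℚ) · hubTime (pos q)
    R w S X : ℚ
    R = recipℕ (PW n k) (twoM (PW n k))
    w = (twoK - 1ℚ) · (fromℕ 2 · R)
    S = (nℚ - 1ℚ) · nℚ · (nℚ + 1ℚ) · (+ 1 / 6)
    X = (twoK - 1ℚ) · (nℚ · nℚ - 1ℚ)
    weight : ∀ c q → A q · π (PW n k) (inj₂ (c , q)) ≡ w · hubTime (pos q)
    weight c q = trans (cong (λ d → A q · (fromℕ d · R)) (deg-inner c q))
      (solve 4 (λ k h t R → (k :- con 1ℚ) :* h :* (t :* R) := (k :- con 1ℚ) :* (t :* R) :* h) refl twoK (hubTime (pos q)) (fromℕ 2) R)
    fromℕ-numerator : fromℕ ((2 * k ∸ 1) * (n * n ∸ 1)) ≡ X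
    fromℕ-numerator = begin
      fromℕ ((2 * k ∸ 1) * (n * n ∸ 1))               ≡⟨ fromℕ-* (2 * k ∸ 1) (n * n ∸ 1) ⟩
      fromℕ (2 * k ∸ 1) · fromℕ (n * n ∸ 1)           ≡⟨ cong₂ _·_ (fromℕ-∸ {2 * k} (s≤s z≤n)) (fromℕ-∸ {n * n} (s≤s z≤n)) ⟩
      (fromℕ (2 * k) - 1ℚ) · (fromℕ (n * n) - 1ℚ)     ≡⟨ cong₂ (λ a b → (a - 1ℚ) · (b - 1ℚ)) (fromℕ-* 2 k) (fromℕ-* n n) ⟩
      X                                               ∎

mainTheorem20 : (n k : ℕ) → 3 ≤ n → 1 ≤ k →
    Σ (FinGraph.V (PW n k) → FinGraph.V (PW n k) → ℚ) (IsHittingTimes (PW n k)) ×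
    ((M : FinGraph.V (PW n k) → FinGraph.V (PW n k) → ℚ) → IsHittingTimes (PW n k) M →
      kemenyOf (PW n k) M ≡ (+ ((2 * k ∸ 1) * (n * n ∸ 1))) / 6)
mainTheorem20 (suc (suc (suc n-3))) (suc k-1) (s≤s (s≤s (s≤s _))) (s≤s _) = (M₀ , M₀-hitting) , kemeny
  where
  open Pinwheel n-3 k-1
  open FinGraph (PW n k) using (verts)
  open Walk (PW n k)
  open Undirected verts-enumerates adj-sym deg≢0
  kemeny : ∀ M → IsHittingTimes (PW n k) M → kemenyOf (PW n k) M ≡ (+ ((2 * k ∸ 1) * (n * n ∸ 1))) / 6
  kemeny M hitting = begin
    kemenyOf (PW n k) M                       ≡⟨ HittingTimes.kemenyOf-row hitting dirichlet hub ⟩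
    ∑ verts (λ j → M hub j · π (PW n k) j)    ≡⟨ ∑-cong verts (λ j → cong (_· π (PW n k) j) (hittingTimes-unique dirichlet hitting M₀-hitting hub j)) ⟩
    ∑ verts (λ j → M₀ hub j · π (PW n k) j)   ≡⟨ hubRow ⟩
    (+ ((2 * k ∸ 1) * (n * n ∸ 1))) / 6       ∎
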